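{- For integers $n\ge 1$, $m\ge 0$ and $l$ with $2\le l\le m+1$, $\chi_{la}(Sp(2n,\,2n+2m+1,\,l))=4$.
   Context: All graphs are finite, simple and connected. For a graph $G=(V,E)$ with $q=|E|$ edges, a local antimagic labeling of $G$ is a bijection $f:E\to\{1,\dots,q\}$ such that $f^+(x)\ne f^+(y)$ for every pair of adjacent vertices $x,y$, where $f^+(x)=\sum_{e\ni x} f(e)$. The local antimagic chromatic number $\chi_{la}(G)$ is the minimum, over all local antimagic labelings $f$ of $G$, of the number of distinct values taken by $f^+$. For integers $y_1,y_2,y_3\ge 1$, the spider $Sp(y_1,y_2,y_3)$ is the tree obtained from three paths of lengths (numbers of edges) $y_1,y_2,y_3$ by identifying one end-vertex of each path into a single vertex (the core). -}

module Defs where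

open import Data.Nat using (ℕ; zero; suc; _+_; _≤_; _≟_)
open import Data.Nat.Properties using ()
open import Data.Fin using (Fin; toℕ)
open import Data.Nat.ListAction using (sum)
open import Data.List using (List; []; _∷_; _++_; map; length; upTo; allFin; lookup; deduplicate)
open import Data.Product using (_×_; _,_; proj₁; proj₂; Σ; ∃)
open import Data.Bool using (if_then_else_)
open import Relation.Nullary using (¬_)
open import Relation.Nullary.Decidable using (⌊_⌋)
open import Function.Definitions using (Bijective)
open import Relation.Binary.PropositionalEquality using (_≡_)

-- A finite graph: vertices are 0 , … , nV - 1 ; edges are an explicit list of
-- unordered pairs (listed as ordered pairs).
record Graph : Set where
  field
    nV    : ℕ
    edges : List (ℕ × ℕ)

open Graph public

nE : Graph → ℕ
nE G = length (edges G)

-- an edge labeling: a bijection from the edges onto {1,…,q};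
-- edge e gets label  1 + toℕ (σ e)  for a bijection σ : Fin q → Fin q.
record Labeling (G : Graph) : Set where
  field
    σ     : Fin (nE G) → Fin (nE G)
    σ-bij : Bijective _≡_ _≡_ σ

open Labeling public

label : {G : Graph} → Labeling G → Fin (nE G) → ℕ
label f e = suc (toℕ (σ f e))

incident : ℕ → ℕ × ℕ → Data.Bool.Bool
incident x (u , v) = Data.Bool._∨_ ⌊ x ≟ u ⌋ ⌊ x ≟ v ⌋

vsum : {G : Graph} → Labeling G → ℕ → ℕ
vsum {G} f x =
  sum (map (λ e → if incident x (lookup (edges G) e) then label f e else 0)
           (allFin (nE G)))

IsLocalAntimagic : {G : Graph} → Labeling G → Set
IsLocalAntimagic {G} f =
  (e : Fin (nE G)) →
    ¬ (vsum f (proj₁ (lookup (edges G) e)) ≡ vsum f (proj₂ (lookup (edges G) e)))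

numColors : {G : Graph} → Labeling G → ℕ
numColors {G} f = length (deduplicate _≟_ (map (vsum f) (upTo (nV G))))

ChiLaEq : Graph → ℕ → Set
ChiLaEq G k =
  (Σ (Labeling G) λ f → IsLocalAntimagic f × numColors f ≡ k)
  × ((f : Labeling G) → IsLocalAntimagic f → k ≤ numColors f)

-- Spider Sp(a,b,c): core vertex 0; leg 1 uses vertices 1..a,
-- leg 2 uses a+1..a+b, leg 3 uses a+b+1..a+b+c (each leg is a path starting at the core).
-- legEdge s i : the i-th edge (0-based) of a leg whose vertices are s+1, s+2, …
legEdge : ℕ → ℕ → ℕ × ℕ
legEdge s zero    = (0 , suc s)
legEdge s (suc i) = (suc s + i , suc s + suc i)

legEdges : ℕ → ℕ → List (ℕ × ℕ)
legEdges s y = map (legEdge s) (upTo y)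

Spider : ℕ → ℕ → ℕ → Graph
Spider a b c = record
  { nV    = suc (a + b + c)
  ; edges = legEdges 0 a ++ legEdges a b ++ legEdges (a + b) c
  }

{-# OPTIONS --safe #-}
module Submission where

-- Let q be the number of edges.  In any labeling the three pendant edges carry distinct labels,
-- which are the vertex sums at the three leaves, and the edge labelled q has an end that is not
-- a leaf, whose sum exceeds q; so at least four sums occur.
--
-- For the matching labeling, each leg is labelled from the core outwards by complementary pairs
-- x, q ∸ x whose first entries drop by 1 or 2 from one pair to the next.  Then the two ends of a
-- pair sum to q, and each vertex between two pairs gets q ∸ 1 or q ∸ 2.  One leg also ends with
-- the label q, which gives a single new sum Z at the vertex before it; when q is even its middle
-- label q / 2 starts another leg, and the core sum is q ∸ 1 (q odd) or Z (q even).  The first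
-- entries are unions of arithmetic progressions, chosen so that every label 1, …, q occurs
-- exactly once, in four families (two for each parity of l).

open import Defs
open import Data.Bool using (if_then_else_)
open import Data.Fin using (Fin; toℕ; fromℕ<; punchOut) renaming (zero to fzero; suc to fsuc)
open import Data.Fin.Properties using (toℕ-fromℕ<; toℕ<n; toℕ-injective; any?; punchOut-injective; injective⇒≤)
  renaming (_≟_ to _≟ᶠ_)
open import Data.List using (List; []; _∷_; _++_; [_]; map; length; upTo; applyUpTo; tabulate; lookup; zipWith; deduplicate)
open import Data.List.Properties using (++-identityʳ; map-tabulate; map-cong; map-cong-local; map-++; ++-assoc; length-++; length-map; length-applyUpTo; length-tabulate; tabulate-cong; tabulate-lookup)
open import Data.List.Membership.Propositional using (_∈_)
open import Data.List.Membership.Propositional.Properties using (∈-++⁺ˡ; ∈-++⁺ʳ; ∈-++⁻; ∈-∃++; ∈-lookup; ∈-deduplicate⁺; ∈-deduplicate⁻; ∈-tabulate⁺)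
open import Data.List.Relation.Binary.Subset.Propositional using (_⊆_)
open import Data.List.Relation.Binary.Subset.Propositional.Properties using (∈-∷⁺ʳ)
open import Data.List.Relation.Unary.All as All using (All; []; _∷_)
open import Data.List.Relation.Unary.All.Properties using (++⁺; ++⁻ˡ; ++⁻ʳ) renaming (tabulate⁺ to All-tabulate⁺)
open import Data.List.Relation.Unary.AllPairs using ([]; _∷_)
open import Data.List.Relation.Unary.Any using (here; there; index)
open import Data.List.Relation.Unary.Any.Properties using (lookup-index)
open import Data.List.Relation.Unary.Linked using (Linked; []; [-]; _∷_)
open import Data.List.Relation.Unary.Unique.Propositional using (Unique)
open import Data.List.Relation.Unary.Unique.Propositional.Properties using (tabulate⁺)
open import Data.Nat using (ℕ; zero; suc; pred; >-nonZero; _+_; _*_; _∸_; _≤_; _<_; _≟_; z≤n; s≤s)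
open import Data.Nat.ListAction using (sum)
open import Data.Nat.ListAction.Properties using (sum-++)
open import Data.Nat.Properties
open import Data.Nat.Tactic.RingSolver using (solve-∀)
open import Data.List.Relation.Unary.Unique.DecPropositional.Properties _≟_ using (deduplicate-!)
open import Data.Product using (Σ-syntax; ∃-syntax; _×_; _,_; proj₁; proj₂)
open import Data.Sum using (_⊎_; inj₁; inj₂)
open import Data.Unit using (⊤; tt)
open import Function using (_∘_; id)
open import Function.Definitions using (Injective; Bijective)
open import Relation.Binary.PropositionalEquality hiding ([_])
open import Relation.Nullary using (yes; no; contradiction)

-- Vertex sums of a spider

range : ℕ → ℕ → List ℕ
range u zero    = []
range u (suc k) = u ∷ range (suc u) k

range-++ : ∀ u a b → range u (a + b) ≡ range u a ++ range (u + a) b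
range-++ u zero    b = cong (λ v → range v b) (sym (+-identityʳ u))
range-++ u (suc a) b = cong (u ∷_) (trans (range-++ (suc u) a b) (cong (λ v → range (suc u) a ++ range v b) (sym (+-suc u a))))

range-bounds : ∀ u k → All (λ x → u ≤ x × x < u + k) (range u k)
range-bounds u zero    = []
range-bounds u (suc k) =
  (≤-refl , m<m+n u (s≤s z≤n)) ∷
  All.map (λ { (u<x , x<) → <⇒≤ u<x , <-≤-trans x< (≤-reflexive (sym (+-suc u k))) }) (range-bounds (suc u) k)

applyUpTo-range : ∀ u k (f : ℕ → ℕ) → (∀ i → f i ≡ u + i) → applyUpTo f k ≡ range u k
applyUpTo-range u zero    f f≗ = refl
applyUpTo-range u (suc k) f f≗ = cong₂ _∷_ (trans (f≗ 0) (+-identityʳ u))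
  (applyUpTo-range (suc u) k (f ∘ suc) (λ i → trans (f≗ (suc i)) (+-suc u i)))

upTo-range : ∀ k → upTo k ≡ range 0 k
upTo-range k = applyUpTo-range 0 k id (λ _ → refl)

incidentWeight : ℕ → ℕ × ℕ → ℕ → ℕ
incidentWeight x e y = if incident x e then y else 0

incidentWeight-fst : ∀ u v y → incidentWeight u (u , v) y ≡ y
incidentWeight-fst u v y with u ≟ u
... | yes _   = refl
... | no u≢u = contradiction refl u≢u

incidentWeight-snd : ∀ u v y → incidentWeight v (u , v) y ≡ y
incidentWeight-snd u v y with v ≟ u | v ≟ v
... | yes _ | _       = refl
... | no _  | yes _   = refl
... | no _  | no v≢v = contradiction refl v≢v

incidentWeight-out : ∀ {x u v} y → x ≢ u → x ≢ v → incidentWeight x (u , v) y ≡ 0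
incidentWeight-out {x} {u} {v} y x≢u x≢v with x ≟ u | x ≟ v
... | yes x≡u | _       = contradiction x≡u x≢u
... | no _    | yes x≡v = contradiction x≡v x≢v
... | no _    | no _    = refl

chain : ℕ → ℕ → List (ℕ × ℕ)
chain u zero    = []
chain u (suc k) = (u , suc u) ∷ chain (suc u) k

pathWeight : ℕ → List ℕ → ℕ → ℕ
pathWeight u ys x = sum (zipWith (incidentWeight x) (chain u (length ys)) ys)

pathWeight-below : ∀ u ys {x} → x < u → pathWeight u ys x ≡ 0
pathWeight-below u []       x<u = refl
pathWeight-below u (y ∷ ys) x<u = cong₂ _+_
  (incidentWeight-out y (<⇒≢ x<u) (<⇒≢ (m<n⇒m<1+n x<u)))
  (pathWeight-below (suc u) ys (m<n⇒m<1+n x<u))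

pathWeight-above : ∀ u ys {x} → u + length ys < x → pathWeight u ys x ≡ 0
pathWeight-above u []       _ = refl
pathWeight-above u (y ∷ ys) {x} u+k<x = cong₂ _+_
  (incidentWeight-out y (>⇒≢ (≤-<-trans (m≤m+n u _) u+k<x)) (>⇒≢ (≤-<-trans (m<m+n u (s≤s z≤n)) u+k<x)))
  (pathWeight-above (suc u) ys (subst (_< x) (+-suc u (length ys)) u+k<x))

pathSums : ℕ → List ℕ → List ℕ
pathSums c []       = c ∷ []
pathSums c (y ∷ ys) = c + y ∷ pathSums y ys

legSums : List ℕ → List ℕ
legSums []       = []
legSums (y ∷ ys) = pathSums y ys

first : List ℕ → ℕ
first []      = 0
first (y ∷ _) = y

coreSum : List ℕ → List ℕ → List ℕ → ℕ
coreSum LA LB LC = first LA + (first LB + first LC)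

spiderSums : List ℕ → List ℕ → List ℕ → List ℕ
spiderSums LA LB LC = coreSum LA LB LC ∷ legSums LA ++ legSums LB ++ legSums LC

pathSums-weights : ∀ p u c ys → p < u →
  map (λ x → incidentWeight x (p , u) c + pathWeight u ys x) (range u (suc (length ys))) ≡ pathSums c ys
pathSums-weights p u c []       p<u = cong (_∷ []) (trans (+-identityʳ _) (incidentWeight-snd p u c))
pathSums-weights p u c (y ∷ ys) p<u = cong₂ _∷_ at-u beyond-u
  where
  at-u : incidentWeight u (p , u) c + pathWeight u (y ∷ ys) u ≡ c + y
  at-u = cong₂ _+_ (incidentWeight-snd p u c)
    (trans (cong₂ _+_ (incidentWeight-fst u (suc u) y) (pathWeight-below (suc u) ys ≤-refl)) (+-identityʳ y))
  beyond-u : map (λ x → incidentWeight x (p , u) c + pathWeight u (y ∷ ys) x) (range (suc u) (suc (length ys)))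
           ≡ pathSums y ys
  beyond-u = trans
    (map-cong-local (All.map (λ {x} (u<x , _) → cong (_+ pathWeight u (y ∷ ys) x) (incidentWeight-out c (>⇒≢ (<-trans p<u u<x)) (>⇒≢ u<x)))
                             (range-bounds (suc u) _)))
    (pathSums-weights u (suc u) y ys ≤-refl)

map-applyUpTo-chain : ∀ u k (g : ℕ → ℕ × ℕ) (f : ℕ → ℕ) → (∀ i → g (f i) ≡ (u + i , suc (u + i))) →
  map g (applyUpTo f k) ≡ chain u k
map-applyUpTo-chain u zero    g f gf≗ = refl
map-applyUpTo-chain u (suc k) g f gf≗ =
  cong₂ _∷_ (trans (gf≗ 0) (cong (λ v → v , suc v) (+-identityʳ u)))
    (map-applyUpTo-chain (suc u) k g (f ∘ suc) (λ i → trans (gf≗ (suc i)) (cong (λ v → v , suc v) (+-suc u i))))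

legEdges-suc : ∀ s k → legEdges s (suc k) ≡ (0 , suc s) ∷ chain (suc s) k
legEdges-suc s k = cong ((0 , suc s) ∷_)
  (map-applyUpTo-chain (suc s) k (legEdge s) suc (λ i → cong (suc s + i ,_) (+-suc (suc s) i)))

length-legEdges : ∀ s k → length (legEdges s k) ≡ k
length-legEdges s k = trans (length-map (legEdge s) (upTo k)) (length-applyUpTo id k)

legWeight : ℕ → List ℕ → ℕ → ℕ
legWeight s L x = sum (zipWith (incidentWeight x) (legEdges s (length L)) L)

legWeight-∷ : ∀ s y ys x → legWeight s (y ∷ ys) x ≡ incidentWeight x (0 , suc s) y + pathWeight (suc s) ys x
legWeight-∷ s y ys x = cong (λ E → sum (zipWith (incidentWeight x) E (y ∷ ys))) (legEdges-suc s (length ys))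

legWeight-core : ∀ s L → legWeight s L 0 ≡ first L
legWeight-core s []       = refl
legWeight-core s (y ∷ ys) = trans (legWeight-∷ s y ys 0)
  (trans (cong₂ _+_ (incidentWeight-fst 0 (suc s) y) (pathWeight-below (suc s) ys (s≤s z≤n))) (+-identityʳ y))

legWeight-own : ∀ s L → map (legWeight s L) (range (suc s) (length L)) ≡ legSums L
legWeight-own s []       = refl
legWeight-own s (y ∷ ys) = trans (map-cong (legWeight-∷ s y ys) (range (suc s) (suc (length ys)))) (pathSums-weights 0 (suc s) y ys (s≤s z≤n))

legWeight-inner : ∀ s L {x} → 0 < x → x ≤ s → legWeight s L x ≡ 0
legWeight-inner s []       0<x x≤s = refl
legWeight-inner s (y ∷ ys) {x} 0<x x≤s = trans (legWeight-∷ s y ys x)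
  (cong₂ _+_ (incidentWeight-out y (>⇒≢ 0<x) (<⇒≢ (s≤s x≤s))) (pathWeight-below (suc s) ys (s≤s x≤s)))

legWeight-outer : ∀ s L {x} → s + length L < x → legWeight s L x ≡ 0
legWeight-outer s []       _     = refl
legWeight-outer s (y ∷ ys) {x} s+k<x = trans (legWeight-∷ s y ys x)
  (cong₂ _+_ (incidentWeight-out y (>⇒≢ (≤-<-trans z≤n s+k<x)) (>⇒≢ (≤-<-trans (m≤m+n (suc s) _) s+k<′x)))
             (pathWeight-above (suc s) ys s+k<′x))
  where
  s+k<′x : suc s + length ys < x
  s+k<′x = ≤-<-trans (≤-reflexive (sym (+-suc s (length ys)))) s+k<x

tabulate-zipWith : ∀ {A B C : Set} (g : A → B → C) (xs : List A) (h : Fin (length xs) → B) →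
  tabulate (λ i → g (lookup xs i) (h i)) ≡ zipWith g xs (tabulate h)
tabulate-zipWith g []       h = refl
tabulate-zipWith g (x ∷ xs) h = cong (g x (h fzero) ∷_) (tabulate-zipWith g xs (h ∘ fsuc))

zipWith-++ : ∀ {A B C : Set} (g : A → B → C) (xs : List A) (ys : List B) {xs′ ys′} → length xs ≡ length ys →
  zipWith g (xs ++ xs′) (ys ++ ys′) ≡ zipWith g xs ys ++ zipWith g xs′ ys′
zipWith-++ g []       []       eq = refl
zipWith-++ g (x ∷ xs) (y ∷ ys) eq = cong (g x y ∷_) (zipWith-++ g xs ys (suc-injective eq))

vsum-zipWith : ∀ {G} (f : Labeling G) x → vsum f x ≡ sum (zipWith (incidentWeight x) (edges G) (tabulate (label f)))
vsum-zipWith {G} f x = cong sum (trans (map-tabulate id _) (tabulate-zipWith (incidentWeight x) (edges G) (label f)))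

AdjacentDistinct : List ℕ → Set
AdjacentDistinct = Linked {A = ℕ} _≢_

Separates : (ℕ → ℕ) → ℕ × ℕ → Set
Separates W e = W (proj₁ e) ≢ W (proj₂ e)

chain-separated : ∀ (W : ℕ → ℕ) u k → AdjacentDistinct (map W (range u (suc k))) → All (Separates W) (chain u k)
chain-separated W u zero    _                 = []
chain-separated W u (suc k) (Wu≢Wu+1 ∷ linked) = Wu≢Wu+1 ∷ chain-separated W (suc u) k linked

legEdges-separated : ∀ (W : ℕ → ℕ) s (L : List ℕ) → AdjacentDistinct (W 0 ∷ map W (range (suc s) (length L))) →
  All (Separates W) (legEdges s (length L))
legEdges-separated W s []       _                = []
legEdges-separated W s (y ∷ ys) (W0≢Ws+1 ∷ linked) =
  subst (All (Separates W)) (sym (legEdges-suc s (length ys))) (W0≢Ws+1 ∷ chain-separated W (suc s) (length ys) linked)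

module SpiderSums (LA LB LC : List ℕ) (f : Labeling (Spider (length LA) (length LB) (length LC)))
                  (f≡ : tabulate (label f) ≡ LA ++ LB ++ LC) where

  private
    a b c : ℕ
    a = length LA
    b = length LB
    c = length LC

  vsum-legWeights : ∀ x → vsum f x ≡ legWeight 0 LA x + (legWeight a LB x + legWeight (a + b) LC x)
  vsum-legWeights x = begin
    vsum f x
      ≡⟨ vsum-zipWith f x ⟩
    sum (zipWith (incidentWeight x) (legEdges 0 a ++ legEdges a b ++ legEdges (a + b) c) (tabulate (label f)))
      ≡⟨ cong (λ L → sum (zipWith (incidentWeight x) (edges (Spider a b c)) L)) f≡ ⟩
    sum (zipWith (incidentWeight x) (legEdges 0 a ++ legEdges a b ++ legEdges (a + b) c) (LA ++ LB ++ LC))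
      ≡⟨ cong sum (zipWith-++ (incidentWeight x) (legEdges 0 a) LA (length-legEdges 0 a)) ⟩
    sum (zipWith (incidentWeight x) (legEdges 0 a) LA ++ zipWith (incidentWeight x) (legEdges a b ++ legEdges (a + b) c) (LB ++ LC))
      ≡⟨ sum-++ (zipWith (incidentWeight x) (legEdges 0 a) LA) _ ⟩
    legWeight 0 LA x + sum (zipWith (incidentWeight x) (legEdges a b ++ legEdges (a + b) c) (LB ++ LC))
      ≡⟨ cong (λ n → legWeight 0 LA x + sum n) (zipWith-++ (incidentWeight x) (legEdges a b) LB (length-legEdges a b)) ⟩
    legWeight 0 LA x + sum (zipWith (incidentWeight x) (legEdges a b) LB ++ zipWith (incidentWeight x) (legEdges (a + b) c) LC)
      ≡⟨ cong (legWeight 0 LA x +_) (sum-++ (zipWith (incidentWeight x) (legEdges a b) LB) _) ⟩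
    legWeight 0 LA x + (legWeight a LB x + legWeight (a + b) LC x)
      ∎
    where open ≡-Reasoning

  vsum-core : vsum f 0 ≡ coreSum LA LB LC
  vsum-core = trans (vsum-legWeights 0)
    (cong₂ _+_ (legWeight-core 0 LA) (cong₂ _+_ (legWeight-core a LB) (legWeight-core (a + b) LC)))

  vsum-legA : map (vsum f) (range 1 a) ≡ legSums LA
  vsum-legA = trans (map-cong-local (All.map on-A (range-bounds 1 a))) (legWeight-own 0 LA)
    where
    on-A : ∀ {x} → 1 ≤ x × x < 1 + a → vsum f x ≡ legWeight 0 LA x
    on-A {x} (0<x , x≤a) = trans (vsum-legWeights x)
      (trans (cong (legWeight 0 LA x +_)
                   (cong₂ _+_ (legWeight-inner a LB 0<x (≤-pred x≤a))
                              (legWeight-inner (a + b) LC 0<x (≤-trans (≤-pred x≤a) (m≤m+n a b)))))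
             (+-identityʳ _))

  vsum-legB : map (vsum f) (range (suc a) b) ≡ legSums LB
  vsum-legB = trans (map-cong-local (All.map on-B (range-bounds (suc a) b))) (legWeight-own a LB)
    where
    on-B : ∀ {x} → suc a ≤ x × x < suc a + b → vsum f x ≡ legWeight a LB x
    on-B {x} (a<x , x≤a+b) = trans (vsum-legWeights x)
      (cong₂ _+_ (legWeight-outer 0 LA a<x)
                 (trans (cong (legWeight a LB x +_) (legWeight-inner (a + b) LC (≤-<-trans z≤n a<x) (≤-pred x≤a+b)))
                        (+-identityʳ _)))

  vsum-legC : map (vsum f) (range (suc (a + b)) c) ≡ legSums LC
  vsum-legC = trans (map-cong-local (All.map on-C (range-bounds (suc (a + b)) c))) (legWeight-own (a + b) LC)
    where
    on-C : ∀ {x} → suc (a + b) ≤ x × x < suc (a + b) + c → vsum f x ≡ legWeight (a + b) LC x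
    on-C {x} (a+b<x , _) = trans (vsum-legWeights x)
      (cong₂ _+_ (legWeight-outer 0 LA (≤-<-trans (m≤m+n a b) a+b<x))
                 (cong (_+ legWeight (a + b) LC x) (legWeight-outer a LB a+b<x)))

  vertexSums : map (vsum f) (upTo (nV (Spider a b c))) ≡ spiderSums LA LB LC
  vertexSums = begin
    map (vsum f) (upTo (suc (a + b + c)))
      ≡⟨ cong (map (vsum f)) (upTo-range (suc (a + b + c))) ⟩
    vsum f 0 ∷ map (vsum f) (range 1 (a + b + c))
      ≡⟨ cong (λ L → vsum f 0 ∷ map (vsum f) L) split ⟩
    vsum f 0 ∷ map (vsum f) (range 1 a ++ range (suc a) b ++ range (suc (a + b)) c)
      ≡⟨ cong₂ _∷_ vsum-core (trans (map-++ (vsum f) (range 1 a) _)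
           (cong₂ _++_ vsum-legA (trans (map-++ (vsum f) (range (suc a) b) _) (cong₂ _++_ vsum-legB vsum-legC)))) ⟩
    spiderSums LA LB LC
      ∎
    where
    open ≡-Reasoning
    split : range 1 (a + b + c) ≡ range 1 a ++ range (suc a) b ++ range (suc (a + b)) c
    split = trans (range-++ 1 (a + b) c)
      (trans (cong (_++ range (suc (a + b)) c) (range-++ 1 a b)) (++-assoc (range 1 a) _ _))

  localAntimagic : AdjacentDistinct (coreSum LA LB LC ∷ legSums LA) → AdjacentDistinct (coreSum LA LB LC ∷ legSums LB) →
    AdjacentDistinct (coreSum LA LB LC ∷ legSums LC) → IsLocalAntimagic f
  localAntimagic distinctA distinctB distinctC e = All.lookup separated (∈-lookup {xs = edges (Spider a b c)} e)
    where
    separated : All (Separates (vsum f)) (edges (Spider a b c))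
    separated = ++⁺ (legEdges-separated (vsum f) 0 LA (subst AdjacentDistinct (sym (cong₂ _∷_ vsum-core vsum-legA)) distinctA))
               (++⁺ (legEdges-separated (vsum f) a LB (subst AdjacentDistinct (sym (cong₂ _∷_ vsum-core vsum-legB)) distinctB))
                    (legEdges-separated (vsum f) (a + b) LC (subst AdjacentDistinct (sym (cong₂ _∷_ vsum-core vsum-legC)) distinctC)))

  numColors-spiderSums : numColors f ≡ length (deduplicate _≟_ (spiderSums LA LB LC))
  numColors-spiderSums = cong (length ∘ deduplicate _≟_) vertexSums

-- At least four vertex sums

∈-++-∷⁻ : ∀ {x z : ℕ} us {vs} → z ∈ us ++ x ∷ vs → z ≢ x → z ∈ us ++ vs
∈-++-∷⁻ us z∈ z≢x with ∈-++⁻ us z∈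
... | inj₁ z∈us          = ∈-++⁺ˡ z∈us
... | inj₂ (here z≡x)    = contradiction z≡x z≢x
... | inj₂ (there z∈vs) = ∈-++⁺ʳ us z∈vs

Unique⇒length≤ : ∀ {xs ys : List ℕ} → Unique xs → xs ⊆ ys → length xs ≤ length ys
Unique⇒length≤ {[]}     _              _    = z≤n
Unique⇒length≤ {x ∷ xs} (x∉xs ∷ uniq) x∷xs⊆ys with ∈-∃++ (x∷xs⊆ys (here refl))
... | us , vs , refl = ≤-trans (s≤s (Unique⇒length≤ uniq xs⊆us++vs)) (≤-reflexive (sym length-us++x∷vs))
  where
  xs⊆us++vs : xs ⊆ us ++ vs
  xs⊆us++vs z∈xs = ∈-++-∷⁻ us (x∷xs⊆ys (there z∈xs)) (≢-sym (All.lookup x∉xs z∈xs))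
  length-us++x∷vs : length (us ++ x ∷ vs) ≡ suc (length (us ++ vs))
  length-us++x∷vs = trans (length-++ us) (trans (+-suc (length us) (length vs)) (cong suc (sym (length-++ us))))

length-deduplicate-≥ : ∀ {ws zs} → Unique ws → ws ⊆ zs → length ws ≤ length (deduplicate _≟_ zs)
length-deduplicate-≥ uniq ws⊆zs = Unique⇒length≤ uniq (∈-deduplicate⁺ _≟_ ∘ ws⊆zs)

length-deduplicate-≤ : ∀ {ws} zs → zs ⊆ ws → length (deduplicate _≟_ zs) ≤ length ws
length-deduplicate-≤ zs zs⊆ws = Unique⇒length≤ (deduplicate-! zs) (zs⊆ws ∘ ∈-deduplicate⁻ _≟_ zs)

Unique-++-≢ : ∀ (xs : List ℕ) {ys x y} → Unique (xs ++ ys) → x ∈ xs → y ∈ ys → x ≢ y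
Unique-++-≢ (u ∷ us) (u∉ ∷ _)    (here refl) y∈ = All.lookup u∉ (∈-++⁺ʳ us y∈)
Unique-++-≢ (u ∷ us) (_ ∷ uniq) (there x∈) y∈ = Unique-++-≢ us uniq x∈ y∈

Unique-++⁻ʳ : ∀ (xs : List ℕ) {ys} → Unique (xs ++ ys) → Unique ys
Unique-++⁻ʳ []       uniq       = uniq
Unique-++⁻ʳ (_ ∷ xs) (_ ∷ uniq) = Unique-++⁻ʳ xs uniq

Bounded : ℕ → ℕ → Set
Bounded q y = 1 ≤ y × y ≤ q

final : List ℕ → ℕ
final []           = 0
final (y ∷ [])     = y
final (_ ∷ z ∷ zs) = final (z ∷ zs)

final-∈ : ∀ L → 1 ≤ length L → final L ∈ L
final-∈ (y ∷ [])     _ = here refl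
final-∈ (y ∷ z ∷ zs) _ = there (final-∈ (z ∷ zs) (s≤s z≤n))

final-∈-pathSums : ∀ y ys → final (y ∷ ys) ∈ pathSums y ys
final-∈-pathSums y []       = here refl
final-∈-pathSums y (z ∷ zs) = there (final-∈-pathSums z zs)

final-∈-legSums : ∀ L → 1 ≤ length L → final L ∈ legSums L
final-∈-legSums (y ∷ ys) _ = final-∈-pathSums y ys

legSums-A⊆ : ∀ LA LB LC → legSums LA ⊆ spiderSums LA LB LC
legSums-A⊆ LA LB LC = there ∘ ∈-++⁺ˡ

legSums-B⊆ : ∀ LA LB LC → legSums LB ⊆ spiderSums LA LB LC
legSums-B⊆ LA LB LC = there ∘ ∈-++⁺ʳ (legSums LA) ∘ ∈-++⁺ˡ

legSums-C⊆ : ∀ LA LB LC → legSums LC ⊆ spiderSums LA LB LC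
legSums-C⊆ LA LB LC = there ∘ ∈-++⁺ʳ (legSums LA) ∘ ∈-++⁺ʳ (legSums LB)

pathSums-exceeds : ∀ {q} y z zs → All (1 ≤_) (y ∷ z ∷ zs) → q ∈ y ∷ z ∷ zs → ∃[ w ] w ∈ pathSums y (z ∷ zs) × q < w
pathSums-exceeds y z zs        (_ ∷ 1≤z ∷ _)  (here refl)          = y + z , here refl , m<m+n y 1≤z
pathSums-exceeds y z zs        (1≤y ∷ _ ∷ _)  (there (here refl)) = y + z , here refl , m<n+m z 1≤y
pathSums-exceeds y z (w ∷ ws) (_ ∷ positive) (there (there q∈))
  with v , v∈ , q<v ← pathSums-exceeds z w ws positive (there q∈) = v , there v∈ , q<v

legSums-exceeds : ∀ {q} L → 2 ≤ length L → All (1 ≤_) L → q ∈ L → ∃[ w ] w ∈ legSums L × q < w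
legSums-exceeds (y ∷ [])     (s≤s ())
legSums-exceeds (y ∷ z ∷ zs) _ = pathSums-exceeds y z zs

spiderSums-≥4 : ∀ q LA LB LC → 2 ≤ length LA → 2 ≤ length LB → 2 ≤ length LC →
  Unique (LA ++ LB ++ LC) → All (Bounded q) (LA ++ LB ++ LC) → q ∈ LA ++ LB ++ LC →
  4 ≤ length (deduplicate _≟_ (spiderSums LA LB LC))
spiderSums-≥4 q LA LB LC 2≤a 2≤b 2≤c uniq bounded q∈L =
  length-deduplicate-≥
    ((ℓA≢ℓB ∷ ℓA≢ℓC ∷ ≢w (∈-++⁺ˡ ℓA∈) ∷ []) ∷ (ℓB≢ℓC ∷ ≢w ℓB∈L ∷ []) ∷ (≢w ℓC∈L ∷ []) ∷ [] ∷ [])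
    (∈-∷⁺ʳ (legSums-A⊆ LA LB LC (final-∈-legSums LA 1≤a))
      (∈-∷⁺ʳ (legSums-B⊆ LA LB LC (final-∈-legSums LB 1≤b))
        (∈-∷⁺ʳ (legSums-C⊆ LA LB LC (final-∈-legSums LC 1≤c))
          (∈-∷⁺ʳ (proj₁ (proj₂ exceeding)) (λ ())))))
  where
  1≤a : 1 ≤ length LA
  1≤a = ≤-trans (s≤s z≤n) 2≤a
  1≤b : 1 ≤ length LB
  1≤b = ≤-trans (s≤s z≤n) 2≤b
  1≤c : 1 ≤ length LC
  1≤c = ≤-trans (s≤s z≤n) 2≤c
  ℓA∈ : final LA ∈ LA
  ℓA∈ = final-∈ LA 1≤a
  ℓB∈ : final LB ∈ LB
  ℓB∈ = final-∈ LB 1≤b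
  ℓC∈ : final LC ∈ LC
  ℓC∈ = final-∈ LC 1≤c
  ℓB∈L : final LB ∈ LA ++ LB ++ LC
  ℓB∈L = ∈-++⁺ʳ LA (∈-++⁺ˡ ℓB∈)
  ℓC∈L : final LC ∈ LA ++ LB ++ LC
  ℓC∈L = ∈-++⁺ʳ LA (∈-++⁺ʳ LB ℓC∈)
  ℓA≢ℓB : final LA ≢ final LB
  ℓA≢ℓB = Unique-++-≢ LA uniq ℓA∈ (∈-++⁺ˡ ℓB∈)
  ℓA≢ℓC : final LA ≢ final LC
  ℓA≢ℓC = Unique-++-≢ LA uniq ℓA∈ (∈-++⁺ʳ LB ℓC∈)
  ℓB≢ℓC : final LB ≢ final LC
  ℓB≢ℓC = Unique-++-≢ LB (Unique-++⁻ʳ LA uniq) ℓB∈ ℓC∈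
  positive : All (1 ≤_) (LA ++ LB ++ LC)
  positive = All.map proj₁ bounded
  exceeding : ∃[ w ] w ∈ spiderSums LA LB LC × q < w
  exceeding with ∈-++⁻ LA q∈L
  ... | inj₁ q∈A with w , w∈ , q<w ← legSums-exceeds LA 2≤a (++⁻ˡ LA positive) q∈A =
    w , legSums-A⊆ LA LB LC w∈ , q<w
  ... | inj₂ q∈BC with ∈-++⁻ LB q∈BC
  ...   | inj₁ q∈B with w , w∈ , q<w ← legSums-exceeds LB 2≤b (++⁻ˡ LB (++⁻ʳ LA positive)) q∈B =
    w , legSums-B⊆ LA LB LC w∈ , q<w
  ...   | inj₂ q∈C with w , w∈ , q<w ← legSums-exceeds LC 2≤c (++⁻ʳ LB (++⁻ʳ LA positive)) q∈C =
    w , legSums-C⊆ LA LB LC w∈ , q<w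
  ≢w : ∀ {x} → x ∈ LA ++ LB ++ LC → x ≢ proj₁ exceeding
  ≢w x∈ = <⇒≢ (≤-<-trans (proj₂ (All.lookup bounded x∈)) (proj₂ (proj₂ exceeding)))

label-bounded : ∀ {G} (f : Labeling G) e → Bounded (nE G) (label f e)
label-bounded f e = s≤s z≤n , toℕ<n (σ f e)

label-injective : ∀ {G} (f : Labeling G) {e e′} → label f e ≡ label f e′ → e ≡ e′
label-injective f eq = proj₁ (σ-bij f) (toℕ-injective (suc-injective eq))

nE-∈-labels : ∀ {G} (f : Labeling G) → 0 < nE G → nE G ∈ tabulate (label f)
nE-∈-labels {G} f 0<q = subst (_∈ tabulate (label f)) label≡q (∈-tabulate⁺ e)
  where
  instance _ = >-nonZero 0<q
  pred-q<q : pred (nE G) < nE G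
  pred-q<q = ≤-reflexive (suc-pred (nE G))
  e : Fin (nE G)
  e = proj₁ (proj₂ (σ-bij f) (fromℕ< pred-q<q))
  label≡q : label f e ≡ nE G
  label≡q = trans (cong (suc ∘ toℕ) (proj₂ (proj₂ (σ-bij f) (fromℕ< pred-q<q)) refl))
                  (trans (cong suc (toℕ-fromℕ< pred-q<q)) (suc-pred (nE G)))

++-split : ∀ {A : Set} a (xs : List A) {b} → length xs ≡ a + b →
  ∃[ ys ] ∃[ zs ] length ys ≡ a × length zs ≡ b × xs ≡ ys ++ zs
++-split zero    xs       eq = [] , xs , refl , eq , refl
++-split (suc a) (x ∷ xs) eq with ys , zs , len-ys , len-zs , xs≡ ← ++-split a xs (suc-injective eq) =
  x ∷ ys , zs , cong suc len-ys , len-zs , cong (x ∷_) xs≡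

nE-Spider : ∀ a b c → nE (Spider a b c) ≡ a + (b + c)
nE-Spider a b c = trans (length-++ (legEdges 0 a))
  (cong₂ _+_ (length-legEdges 0 a) (trans (length-++ (legEdges a b)) (cong₂ _+_ (length-legEdges a b) (length-legEdges (a + b) c))))

numColors-≥4 : ∀ {a b c} → 2 ≤ a → 2 ≤ b → 2 ≤ c → (f : Labeling (Spider a b c)) → 4 ≤ numColors f
numColors-≥4 {a} {b} {c} 2≤a 2≤b 2≤c f
  with LA , LBC , refl , len-LBC , f≡ ← ++-split a (tabulate (label f)) (trans (length-tabulate (label f)) (nE-Spider a b c))
  with LB , LC , refl , refl , refl ← ++-split b LBC len-LBC =
  subst (4 ≤_) (sym (SpiderSums.numColors-spiderSums LA LB LC f f≡))
    (spiderSums-≥4 (nE (Spider a b c)) LA LB LC 2≤a 2≤b 2≤c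
      (subst Unique f≡ (tabulate⁺ (label-injective f)))
      (subst (All (Bounded _)) f≡ (All-tabulate⁺ (label-bounded f)))
      (subst (_ ∈_) f≡ (nE-∈-labels f 0<q)))
  where
  0<q : 0 < nE (Spider a b c)
  0<q = subst (0 <_) (sym (nE-Spider a b c)) (≤-trans (s≤s z≤n) (≤-trans 2≤a (m≤m+n a (b + c))))

-- Labelings from arrangements of 1, …, q

IsArrangement : ℕ → List ℕ → Set
IsArrangement q L = length L ≡ q × All (Bounded q) L × (∀ {y} → Bounded q y → y ∈ L)

injective⇒surjective : ∀ {n} {g : Fin n → Fin n} → Injective _≡_ _≡_ g → ∀ x → ∃[ a ] g a ≡ x
injective⇒surjective {suc m} {g} g-inj x with any? (λ a → g a ≟ᶠ x)
... | yes hit  = hit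
... | no miss = contradiction (injective⇒≤ punched-inj) 1+n≰n
  where
  x≢g : ∀ a → x ≢ g a
  x≢g a x≡ga = miss (a , sym x≡ga)
  punched-inj : Injective _≡_ _≡_ (λ a → punchOut (x≢g a))
  punched-inj {a} {b} eq = g-inj (punchOut-injective (x≢g a) (x≢g b) eq)

rightInverse⇒injective : ∀ {n} (π g : Fin n → Fin n) → (∀ y → π (g y) ≡ y) → Injective _≡_ _≡_ π
rightInverse⇒injective π g πg≗id {x} {y} πx≡πy = trans (sym (proj₂ x-hit)) (trans (cong g a≡b) (proj₂ y-hit))
  where
  g-inj : Injective _≡_ _≡_ g
  g-inj {a} {b} ga≡gb = trans (sym (πg≗id a)) (trans (cong π ga≡gb) (πg≗id b))
  x-hit : ∃[ a ] g a ≡ x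
  x-hit = injective⇒surjective g-inj x
  y-hit : ∃[ b ] g b ≡ y
  y-hit = injective⇒surjective g-inj y
  a≡b : proj₁ x-hit ≡ proj₁ y-hit
  a≡b = trans (sym (πg≗id _)) (trans (cong π (proj₂ x-hit)) (trans πx≡πy (trans (cong π (sym (proj₂ y-hit))) (πg≗id _))))

permutation-from-arrangement : ∀ q L → IsArrangement q L →
  Σ[ π ∈ (Fin q → Fin q) ] Bijective _≡_ _≡_ π × tabulate (λ e → suc (toℕ (π e))) ≡ L
permutation-from-arrangement .(length L) L (refl , bounded , complete) =
  π , (rightInverse⇒injective π g πg≗id , λ y → g y , λ z≡gy → trans (cong π z≡gy) (πg≗id y)) ,
  trans (tabulate-cong π≗lookup) (tabulate-lookup L)
  where
  pred< : ∀ {y q} → Bounded q y → pred y < q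
  pred< {suc y} (_ , y<q) = y<q
  π : Fin (length L) → Fin (length L)
  π e = fromℕ< (pred< (All.lookup bounded (∈-lookup e)))
  π≗lookup : ∀ e → suc (toℕ (π e)) ≡ lookup L e
  π≗lookup e with All.lookup bounded (∈-lookup e)
  ... | 1≤y , _ = trans (cong suc (toℕ-fromℕ< _)) (suc-pred (lookup L e) {{>-nonZero 1≤y}})
  g : Fin (length L) → Fin (length L)
  g y = index (complete (s≤s z≤n , toℕ<n y))
  πg≗id : ∀ y → π (g y) ≡ y
  πg≗id y = toℕ-injective (suc-injective (trans (π≗lookup (g y)) (sym (lookup-index (complete (s≤s z≤n , toℕ<n y))))))

labeling-from-arrangement : ∀ G {L} → IsArrangement (nE G) L → Σ[ f ∈ Labeling G ] tabulate (label f) ≡ L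
labeling-from-arrangement G {L} arrangement
  with π , π-bij , tabulate≡ ← permutation-from-arrangement (nE G) L arrangement =
  record { σ = π ; σ-bij = π-bij } , tabulate≡

spider-χla≡4 : ∀ LA LB LC cs → 2 ≤ length LA → 2 ≤ length LB → 2 ≤ length LC →
  IsArrangement (nE (Spider (length LA) (length LB) (length LC))) (LA ++ LB ++ LC) →
  AdjacentDistinct (coreSum LA LB LC ∷ legSums LA) →
  AdjacentDistinct (coreSum LA LB LC ∷ legSums LB) →
  AdjacentDistinct (coreSum LA LB LC ∷ legSums LC) →
  Unique cs → length cs ≡ 4 → spiderSums LA LB LC ⊆ cs → cs ⊆ spiderSums LA LB LC →
  ChiLaEq (Spider (length LA) (length LB) (length LC)) 4
spider-χla≡4 LA LB LC cs 2≤a 2≤b 2≤c arrangement distinctA distinctB distinctC cs-unique |cs|≡4 sums⊆cs cs⊆sums =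
  (f , SpiderSums.localAntimagic LA LB LC f f≡ distinctA distinctB distinctC ,
   trans (SpiderSums.numColors-spiderSums LA LB LC f f≡)
         (≤-antisym (subst (_ ≤_) |cs|≡4 (length-deduplicate-≤ _ sums⊆cs))
                    (subst (_≤ _) |cs|≡4 (length-deduplicate-≥ cs-unique cs⊆sums)))) ,
  (λ g _ → numColors-≥4 2≤a 2≤b 2≤c g)
  where
  f : Labeling (Spider (length LA) (length LB) (length LC))
  f = proj₁ (labeling-from-arrangement (Spider (length LA) (length LB) (length LC)) arrangement)
  f≡ : tabulate (label f) ≡ LA ++ LB ++ LC
  f≡ = proj₂ (labeling-from-arrangement (Spider (length LA) (length LB) (length LC)) arrangement)

-- Legs labelled by complementary pairs

Inner : ℕ → ℕ → Set
Inner q x = 1 ≤ x × x < q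

StepDown : ℕ → ℕ → Set
StepDown x y = x ≡ 1 + y ⊎ x ≡ 2 + y

StepsDown : List ℕ → Set
StepsDown = Linked StepDown

pairUp : ℕ → List ℕ → List ℕ → List ℕ
pairUp q []       T = T
pairUp q (x ∷ xs) T = x ∷ q ∸ x ∷ pairUp q xs T

length-pairUp : ∀ q xs T → length (pairUp q xs T) ≡ length xs * 2 + length T
length-pairUp q []       T = refl
length-pairUp q (x ∷ xs) T = cong (suc ∘ suc) (length-pairUp q xs T)

pairUp-bounded : ∀ {q xs T} → All (Inner q) xs → All (Bounded q) T → All (Bounded q) (pairUp q xs T)
pairUp-bounded []                  T-bounded = T-bounded
pairUp-bounded {q} {x ∷ _} ((1≤x , x<q) ∷ inner) T-bounded =
  (1≤x , <⇒≤ x<q) ∷ (m<n⇒0<n∸m x<q , m∸n≤m q x) ∷ pairUp-bounded inner T-bounded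

∈-pairUp : ∀ q {x xs} T → x ∈ xs → x ∈ pairUp q xs T × q ∸ x ∈ pairUp q xs T
∈-pairUp q T (here refl) = here refl , there (here refl)
∈-pairUp q T (there x∈)  = let x∈′ , q∸x∈′ = ∈-pairUp q T x∈ in there (there x∈′) , there (there q∸x∈′)

∸-< : ∀ {q d} → 1 ≤ q → 1 ≤ d → q ∸ d < q
∸-< {suc q} {suc d} _ _ = s≤s (m∸n≤m q d)

∸-+-cancel : ∀ q d y → d + y ≤ q → q ∸ (d + y) + y ≡ q ∸ d
∸-+-cancel q d y d+y≤q = trans (cong (_+ y) (sym (∸-+-assoc q d y)))
  (m∸n+n≡m (subst (_≤ q ∸ d) (m+n∸m≡n d y) (∸-monoˡ-≤ d d+y≤q)))

complement-step : ∀ {q x y} → StepDown x y → x ≤ q → q ∸ x + y ≡ q ∸ 1 ⊎ q ∸ x + y ≡ q ∸ 2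
complement-step {q} {y = y} (inj₁ refl) x≤q = inj₁ (∸-+-cancel q 1 y x≤q)
complement-step {q} {y = y} (inj₂ refl) x≤q = inj₂ (∸-+-cancel q 2 y x≤q)

complement-step-∈ : ∀ {q x y cs} → q ∸ 1 ∈ cs → q ∸ 2 ∈ cs → StepDown x y → x ≤ q → q ∸ x + y ∈ cs
complement-step-∈ {cs = cs} q-1∈ q-2∈ x↘y x≤q with complement-step x↘y x≤q
... | inj₁ e = subst (_∈ cs) (sym e) q-1∈
... | inj₂ e = subst (_∈ cs) (sym e) q-2∈

complement-step-≢ : ∀ {q x y} → 1 ≤ q → StepDown x y → x ≤ q → q ∸ x + y ≢ q
complement-step-≢ {q} 1≤q x↘y x≤q with complement-step x↘y x≤q
... | inj₁ e = <⇒≢ (subst (_< q) (sym e) (∸-< 1≤q (s≤s z≤n)))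
... | inj₂ e = <⇒≢ (subst (_< q) (sym e) (∸-< 1≤q (s≤s z≤n)))

pairPath-⊆ : ∀ {cs} q x xs T → q ∈ cs → q ∸ 1 ∈ cs → q ∸ 2 ∈ cs → StepsDown (x ∷ xs) → All (Inner q) (x ∷ xs) →
  pathSums (q ∸ final (x ∷ xs)) T ⊆ cs → pathSums (q ∸ x) (pairUp q xs T) ⊆ cs
pairPath-⊆ q x []       T _  _    _    _              _                   tail⊆ = tail⊆
pairPath-⊆ {cs} q x (y ∷ ys) T q∈ q-1∈ q-2∈ (x↘y ∷ steps) ((_ , x<q) ∷ inner) tail⊆ =
  ∈-∷⁺ʳ (complement-step-∈ q-1∈ q-2∈ x↘y (<⇒≤ x<q))
    (∈-∷⁺ʳ (subst (_∈ cs) (sym (m+[n∸m]≡n (<⇒≤ (proj₂ (All.head inner))))) q∈)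
      (pairPath-⊆ q y ys T q∈ q-1∈ q-2∈ steps inner tail⊆))

legSums-pairUp-⊆ : ∀ {cs} q x xs T → q ∈ cs → q ∸ 1 ∈ cs → q ∸ 2 ∈ cs → StepsDown (x ∷ xs) → All (Inner q) (x ∷ xs) →
  pathSums (q ∸ final (x ∷ xs)) T ⊆ cs → legSums (pairUp q (x ∷ xs) T) ⊆ cs
legSums-pairUp-⊆ {cs} q x xs T q∈ q-1∈ q-2∈ steps inner tail⊆ =
  ∈-∷⁺ʳ (subst (_∈ cs) (sym (m+[n∸m]≡n (<⇒≤ (proj₂ (All.head inner))))) q∈) (pairPath-⊆ q x xs T q∈ q-1∈ q-2∈ steps inner tail⊆)

pairPath-distinct : ∀ q x xs T → 1 ≤ q → StepsDown (x ∷ xs) → All (Inner q) (x ∷ xs) →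
  AdjacentDistinct (q ∷ pathSums (q ∸ final (x ∷ xs)) T) → AdjacentDistinct (q ∷ pathSums (q ∸ x) (pairUp q xs T))
pairPath-distinct q x []       T _   _              _                   tail-distinct = tail-distinct
pairPath-distinct q x (y ∷ ys) T 1≤q (x↘y ∷ steps) ((_ , x<q) ∷ inner) tail-distinct =
  ≢-sym step≢q ∷ (λ e → step≢q (trans e (m+[n∸m]≡n y≤q)))
  ∷ subst (λ v → AdjacentDistinct (v ∷ pathSums (q ∸ y) (pairUp q ys T))) (sym (m+[n∸m]≡n y≤q)) (pairPath-distinct q y ys T 1≤q steps inner tail-distinct)
  where
  y≤q : y ≤ q
  y≤q = <⇒≤ (proj₂ (All.head inner))
  step≢q : q ∸ x + y ≢ q
  step≢q = complement-step-≢ 1≤q x↘y (<⇒≤ x<q)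

legSums-pairUp-distinct : ∀ q x xs T {c} → 1 ≤ q → c ≢ q → StepsDown (x ∷ xs) → All (Inner q) (x ∷ xs) →
  AdjacentDistinct (q ∷ pathSums (q ∸ final (x ∷ xs)) T) → AdjacentDistinct (c ∷ legSums (pairUp q (x ∷ xs) T))
legSums-pairUp-distinct q x xs T 1≤q c≢q steps inner tail-distinct =
  (λ e → c≢q (trans e x+q-x≡q))
  ∷ subst (λ v → AdjacentDistinct (v ∷ pathSums (q ∸ x) (pairUp q xs T))) (sym x+q-x≡q) (pairPath-distinct q x xs T 1≤q steps inner tail-distinct)
  where
  x+q-x≡q : x + (q ∸ x) ≡ q
  x+q-x≡q = m+[n∸m]≡n (<⇒≤ (proj₂ (All.head inner)))

pairPath-tail-⊆ : ∀ q x xs T → pathSums (q ∸ final (x ∷ xs)) T ⊆ pathSums (q ∸ x) (pairUp q xs T)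
pairPath-tail-⊆ q x []       T = id
pairPath-tail-⊆ q x (y ∷ ys) T = there ∘ there ∘ pairPath-tail-⊆ q y ys T

legSums-pairUp-tail-⊆ : ∀ q x xs T → pathSums (q ∸ final (x ∷ xs)) T ⊆ legSums (pairUp q (x ∷ xs) T)
legSums-pairUp-tail-⊆ q x xs T = there ∘ pairPath-tail-⊆ q x xs T

q∈legSums-pairUp : ∀ q x xs T → x ≤ q → q ∈ legSums (pairUp q (x ∷ xs) T)
q∈legSums-pairUp q x xs T x≤q = here (sym (m+[n∸m]≡n x≤q))

-- Covering 1, …, q by complementary pairs

PairCovered : ℕ → List ℕ → ℕ → Set
PairCovered q X s = s ∈ X ⊎ q ∸ s ∈ X

Covers : (ℕ → Set) → ℕ → ℕ → Set
Covers P lo hi = ∀ {s} → lo ≤ s → s < hi → P s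

PairsIn : ℕ → List ℕ → List ℕ → Set
PairsIn q X L = ∀ {x} → x ∈ X → x ∈ L × q ∸ x ∈ L

pairCovered-∈ : ∀ {q X L s} → PairsIn q X L → s ≤ q → PairCovered q X s → s ∈ L × q ∸ s ∈ L
pairCovered-∈ pairs∈L s≤q (inj₁ s∈X)   = pairs∈L s∈X
pairCovered-∈ {L = L} pairs∈L s≤q (inj₂ q∸s∈X) =
  let q∸s∈ , s∈ = pairs∈L q∸s∈X in subst (_∈ L) (m∸[m∸n]≡n s≤q) s∈ , q∸s∈

arrangement-complete : ∀ {q N X L} → N ≤ q → PairsIn q X L → Covers (PairCovered q X) 1 (suc N) →
  (∀ {y} → N < y → y < q ∸ N → y ∈ L) → q ∈ L → ∀ {y} → Bounded q y → y ∈ L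
arrangement-complete {q} {N} N≤q pairs∈L covered middle q∈L {y} (1≤y , y≤q) with y ≤? N
... | yes y≤N = proj₁ (pairCovered-∈ pairs∈L y≤q (covered 1≤y (s≤s y≤N)))
... | no y≰N with y <? q ∸ N
...   | yes y<q∸N = middle (≰⇒> y≰N) y<q∸N
...   | no y≮q∸N with y ≟ q
...     | yes refl = q∈L
...     | no y≢q   = subst (_∈ _) (m∸[m∸n]≡n y≤q)
  (proj₂ (pairCovered-∈ pairs∈L (m∸n≤m q y) (covered (m<n⇒0<n∸m (≤∧≢⇒< y≤q y≢q)) (s≤s q∸y≤N))))
  where
  q∸y≤N : q ∸ y ≤ N
  q∸y≤N = ≤-trans (∸-monoʳ-≤ q (≮⇒≥ y≮q∸N)) (≤-reflexive (m∸[m∸n]≡n N≤q))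

covers-join : ∀ {P lo mid mid′ hi} → mid′ ≤ mid → Covers P lo mid → Covers P mid′ hi → Covers P lo hi
covers-join {mid = mid} mid′≤mid left right {s} lo≤s s<hi with s <? mid
... | yes s<mid = left lo≤s s<mid
... | no s≮mid  = right (≤-trans mid′≤mid (≮⇒≥ s≮mid)) s<hi

covers-shrink : ∀ {P lo hi hi′} → hi′ ≤ hi → Covers P lo hi → Covers P lo hi′
covers-shrink hi′≤hi covered lo≤s s<hi′ = covered lo≤s (<-≤-trans s<hi′ hi′≤hi)

descAP : ℕ → ℕ → ℕ → List ℕ
descAP b d zero    = []
descAP b d (suc k) = k * d + b ∷ descAP b d k

length-descAP : ∀ b d k → length (descAP b d k) ≡ k
length-descAP b d zero    = refl
length-descAP b d (suc k) = cong suc (length-descAP b d k)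

∈-descAP⁻ : ∀ {b d k s} → s ∈ descAP b d k → ∃[ i ] i < k × s ≡ i * d + b
∈-descAP⁻ {k = suc k} (here refl) = k , ≤-refl , refl
∈-descAP⁻ {k = suc k} (there s∈) with i , i<k , s≡ ← ∈-descAP⁻ s∈ = i , m<n⇒m<1+n i<k , s≡

∈-descAP⁺ : ∀ {b d k} i → i < k → i * d + b ∈ descAP b d k
∈-descAP⁺ {k = suc k} i i<1+k with i ≟ k
... | yes refl = here refl
... | no i≢k  = there (∈-descAP⁺ i (≤∧≢⇒< (≤-pred i<1+k) i≢k))

descAP-+ : ∀ b d k k′ → descAP b d (k′ + k) ≡ descAP (k * d + b) d k′ ++ descAP b d k
descAP-+ b d k zero     = refl
descAP-+ b d k (suc k′) = cong₂ _∷_ (reassoc k′ k d b) (descAP-+ b d k k′)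
  where
  reassoc : ∀ k′ k d b → (k′ + k) * d + b ≡ k′ * d + (k * d + b)
  reassoc = solve-∀

descAP-upper⊆ : ∀ b d k k′ → descAP (b + k * d) d k′ ⊆ descAP b d (k + k′)
descAP-upper⊆ b d k k′ rewrite +-comm b (k * d) | +-comm k k′ = subst (_ ∈_) (sym (descAP-+ b d k k′)) ∘ ∈-++⁺ˡ

descAP-lower⊆ : ∀ b d k k′ → descAP b d k ⊆ descAP b d (k + k′)
descAP-lower⊆ b d k k′ rewrite +-comm k k′ = subst (_ ∈_) (sym (descAP-+ b d k k′)) ∘ ∈-++⁺ʳ _

descAP-mirror : ∀ {q b b′ d k s} → q ≡ k * d + b + b′ → s ∈ descAP b d (suc k) → q ∸ s ∈ descAP b′ d (suc k)
descAP-mirror {q} {b} {b′} {d} {k} q≡ s∈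
  with i , i<1+k , refl ← ∈-descAP⁻ s∈
  with w , refl ← m≤n⇒∃[o]m+o≡n (≤-pred i<1+k) =
  subst (_∈ descAP b′ d (suc (i + w))) (sym q∸s≡) (∈-descAP⁺ w (s≤s (m≤n+m w i)))
  where
  split : ∀ i w d b b′ → (i + w) * d + b + b′ ≡ (i * d + b) + (w * d + b′)
  split = solve-∀
  q∸s≡ : q ∸ (i * d + b) ≡ w * d + b′
  q∸s≡ = trans (cong (_∸ (i * d + b)) (trans q≡ (split i w d b b′))) (m+n∸m≡n (i * d + b) (w * d + b′))

covers-descAP₁ : ∀ {P} b k → (∀ {s} → s ∈ descAP b 1 k → P s) → Covers P b (k * 1 + b)
covers-descAP₁ b zero    _ b≤s s<b = contradiction b≤s (<⇒≱ s<b)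
covers-descAP₁ {P} b (suc k) P-on {s} b≤s s<top with s <? k * 1 + b
... | yes s<k+b = covers-descAP₁ b k (P-on ∘ there) b≤s s<k+b
... | no s≮k+b  = subst P (sym (≤-antisym (≤-pred s<top) (≮⇒≥ s≮k+b))) (P-on (here refl))

covers-descAP₂ : ∀ {P} b k → (∀ {s} → s ∈ descAP b 2 k → P s) → (∀ {s} → s ∈ descAP (suc b) 2 k → P s) →
  Covers P b (k * 2 + b)
covers-descAP₂ b zero    _      _     b≤s s<b = contradiction b≤s (<⇒≱ s<b)
covers-descAP₂ {P} b (suc k) P-even P-odd {s} b≤s s<top with s <? k * 2 + b
... | yes s<k2+b = covers-descAP₂ b k (P-even ∘ there) (P-odd ∘ there) b≤s s<k2+b
... | no s≮k2+b with s ≟ k * 2 + b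
...   | yes refl = P-even (here refl)
...   | no s≢k2+b = subst P (sym s≡) (P-odd (here refl))
  where
  s≡ : s ≡ k * 2 + suc b
  s≡ = trans (≤-antisym (≤-pred s<top) (≤∧≢⇒< (≮⇒≥ s≮k2+b) (≢-sym s≢k2+b))) (sym (+-suc (k * 2) b))

descAP₁-steps : ∀ b k → StepsDown (descAP b 1 k)
descAP₁-steps b zero          = []
descAP₁-steps b (suc zero)    = [-]
descAP₁-steps b (suc (suc k)) = inj₁ refl ∷ descAP₁-steps b (suc k)

descAP₂-steps : ∀ b k → StepsDown (descAP b 2 k)
descAP₂-steps b zero          = []
descAP₂-steps b (suc zero)    = [-]
descAP₂-steps b (suc (suc k)) = inj₂ refl ∷ descAP₂-steps b (suc k)

final-descAP : ∀ b d k → final (descAP b d (suc k)) ≡ b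
final-descAP b d zero    = refl
final-descAP b d (suc k) = final-descAP b d k

final-++ : ∀ xs y ys → final (xs ++ y ∷ ys) ≡ final (y ∷ ys)
final-++ []            y ys = refl
final-++ (x ∷ [])      y ys = refl
final-++ (x ∷ x′ ∷ xs) y ys = final-++ (x′ ∷ xs) y ys

Joins : List ℕ → List ℕ → Set
Joins (x ∷ xs) (y ∷ ys) = StepDown (final (x ∷ xs)) y
Joins _        _        = ⊤

StepsDown-++ : ∀ xs ys → StepsDown xs → StepsDown ys → Joins xs ys → StepsDown (xs ++ ys)
StepsDown-++ []            ys       _                 steps-ys _    = steps-ys
StepsDown-++ (x ∷ xs)      []       steps-xs          _        _    = subst StepsDown (sym (++-identityʳ (x ∷ xs))) steps-xs
StepsDown-++ (x ∷ [])      (y ∷ ys) _                 steps-ys join = join ∷ steps-ys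
StepsDown-++ (x ∷ x′ ∷ xs) (y ∷ ys) (x↘x′ ∷ steps-xs) steps-ys join = x↘x′ ∷ StepsDown-++ (x′ ∷ xs) (y ∷ ys) steps-xs steps-ys join

descAP-inner : ∀ {q} b d k → 1 ≤ b → 1 ≤ d → k * d + b ≤ q → All (Inner q) (descAP b d k)
descAP-inner b d zero    _   _   _     = []
descAP-inner b d (suc k) 1≤b 1≤d top≤q =
  (≤-trans 1≤b (m≤n+m b (k * d)) , <-≤-trans head<top top≤q) ∷ descAP-inner b d k 1≤b 1≤d (≤-trans (<⇒≤ head<top) top≤q)
  where
  head<top : k * d + b < suc k * d + b
  head<top = +-monoˡ-< b (+-monoˡ-≤ (k * d) 1≤d)

-- Spiders labelled by complementary pairs

++-⊆ : ∀ {xs ys zs : List ℕ} → xs ⊆ zs → ys ⊆ zs → xs ++ ys ⊆ zs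
++-⊆ {xs} xs⊆zs ys⊆zs p with ∈-++⁻ xs p
... | inj₁ p∈xs = xs⊆zs p∈xs
... | inj₂ p∈ys = ys⊆zs p∈ys

∈-pairUp-tail : ∀ q xs {y T} → y ∈ T → y ∈ pairUp q xs T
∈-pairUp-tail q []       y∈ = y∈
∈-pairUp-tail q (x ∷ xs) y∈ = there (there (∈-pairUp-tail q xs y∈))

PairsIn-++ : ∀ {q XA XB XC LA LB LC} → PairsIn q XA LA → PairsIn q XB LB → PairsIn q XC LC →
  PairsIn q (XA ++ XB ++ XC) (LA ++ LB ++ LC)
PairsIn-++ {XA = XA} {XB} {LA = LA} {LB} inA inB inC x∈ with ∈-++⁻ XA x∈
... | inj₁ x∈A = let p , p′ = inA x∈A in ∈-++⁺ˡ p , ∈-++⁺ˡ p′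
... | inj₂ x∈BC with ∈-++⁻ XB x∈BC
...   | inj₁ x∈B = let p , p′ = inB x∈B in ∈-++⁺ʳ LA (∈-++⁺ˡ p) , ∈-++⁺ʳ LA (∈-++⁺ˡ p′)
...   | inj₂ x∈C = let p , p′ = inC x∈C in ∈-++⁺ʳ LA (∈-++⁺ʳ LB p) , ∈-++⁺ʳ LA (∈-++⁺ʳ LB p′)

spider-arrangement : ∀ {q} LA LB LC → length LA + (length LB + length LC) ≡ q →
  All (Bounded q) (LA ++ LB ++ LC) → (∀ {y} → Bounded q y → y ∈ LA ++ LB ++ LC) →
  IsArrangement (nE (Spider (length LA) (length LB) (length LC))) (LA ++ LB ++ LC)
spider-arrangement LA LB LC size≡q bounded complete =
  subst (λ n → IsArrangement n (LA ++ LB ++ LC)) (trans (sym size≡q) (sym (nE-Spider (length LA) (length LB) (length LC))))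
    (trans (trans (length-++ LA) (cong (length LA +_) (length-++ LB))) size≡q , bounded , complete)

ChiLaEq-Spider : ∀ {a b c a′ b′ c′ k} → a ≡ a′ → b ≡ b′ → c ≡ c′ → ChiLaEq (Spider a b c) k → ChiLaEq (Spider a′ b′ c′) k
ChiLaEq-Spider refl refl refl χ = χ

four-colours-unique : ∀ {q Z} → 2 ≤ q → q < Z → Unique (q ∷ q ∸ 1 ∷ q ∸ 2 ∷ Z ∷ [])
four-colours-unique {suc (suc q)} (s≤s (s≤s z≤n)) q+2<Z =
  (>⇒≢ q+1<q+2 ∷ >⇒≢ q<q+2 ∷ <⇒≢ q+2<Z ∷ []) ∷ (>⇒≢ (n<1+n q) ∷ <⇒≢ (<-trans q+1<q+2 q+2<Z) ∷ []) ∷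
  (<⇒≢ (<-trans q<q+2 q+2<Z) ∷ []) ∷ [] ∷ []
  where
  q+1<q+2 : suc q < suc (suc q)
  q+1<q+2 = n<1+n (suc q)
  q<q+2 : q < suc (suc q)
  q<q+2 = m<n⇒m<1+n (n<1+n q)

All-final : ∀ {P : ℕ → Set} {x xs} → All P (x ∷ xs) → P (final (x ∷ xs))
All-final {x = x} {xs} all = All.lookup all (final-∈ (x ∷ xs) (s≤s z≤n))

leaf-distinct : ∀ {q ℓ} → 1 ≤ q → 1 ≤ ℓ → AdjacentDistinct (q ∷ pathSums (q ∸ ℓ) [])
leaf-distinct 1≤q 1≤ℓ = >⇒≢ (∸-< 1≤q 1≤ℓ) ∷ [-]

pendant-distinct : ∀ {q ℓ} → ℓ < q → AdjacentDistinct (q ∷ pathSums (q ∸ ℓ) [ q ])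
pendant-distinct {q} ℓ<q = <⇒≢ q<Z ∷ >⇒≢ q<Z ∷ [-]
  where
  q<Z = m<n+m q (m<n⇒0<n∸m ℓ<q)

evenPairs-arrangement : ∀ q N XA XB XC → q ≡ suc (N + N) → length XA + length XB + length XC ≡ N →
  All (Inner q) (XA ++ XB ++ XC) → Covers (PairCovered q (XA ++ XB ++ XC)) 1 (suc N) →
  let LA = pairUp q XA [] ; LB = pairUp q XB [ q ] ; LC = pairUp q XC [] in
  IsArrangement (nE (Spider (length LA) (length LB) (length LC))) (LA ++ LB ++ LC)
evenPairs-arrangement q N XA XB XC q≡ |X|≡N inner covered = spider-arrangement LA LB LC
  (trans (cong₂ _+_ (length-pairUp q XA []) (cong₂ _+_ (length-pairUp q XB [ q ]) (length-pairUp q XC [])))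
         (trans (size (length XA) (length XB) (length XC)) (trans (cong (λ n → suc (n + n)) |X|≡N) (sym q≡))))
  (++⁺ (pairUp-bounded (++⁻ˡ XA inner) [])
       (++⁺ (pairUp-bounded (++⁻ˡ XB (++⁻ʳ XA inner)) ((1≤q , ≤-refl) ∷ [])) (pairUp-bounded (++⁻ʳ XB (++⁻ʳ XA inner)) [])))
  (arrangement-complete (subst (N ≤_) (sym q≡) (≤-trans (m≤m+n N N) (n≤1+n _)))
    (PairsIn-++ {XA = XA} {XB} {XC} (∈-pairUp q []) (∈-pairUp q [ q ]) (∈-pairUp q []))
    covered no-middle
    (∈-++⁺ʳ LA (∈-++⁺ˡ (∈-pairUp-tail q XB (here refl)))))
  where
  LA LB LC : List ℕ
  LA = pairUp q XA []
  LB = pairUp q XB [ q ]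
  LC = pairUp q XC []
  1≤q : 1 ≤ q
  1≤q = subst (1 ≤_) (sym q≡) (s≤s z≤n)
  size : ∀ a b c → a * 2 + 0 + (b * 2 + 1 + (c * 2 + 0)) ≡ suc (a + b + c + (a + b + c))
  size = solve-∀
  q∸N≡ : q ∸ N ≡ suc N
  q∸N≡ = trans (cong (_∸ N) (trans q≡ (sym (+-suc N N)))) (m+n∸m≡n N (suc N))
  no-middle : ∀ {y} → N < y → y < q ∸ N → y ∈ LA ++ LB ++ LC
  no-middle {y} N<y y<q∸N = contradiction (≤-pred (subst (y <_) q∸N≡ y<q∸N)) (<⇒≱ N<y)

oddPairs-arrangement : ∀ q N XA XB XC → q ≡ suc (suc (N + N)) → length XA + length XB + length XC ≡ N →
  All (Inner q) (XA ++ XB ++ XC) → Covers (PairCovered q (XA ++ XB ++ XC)) 1 (suc N) →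
  let LA = pairUp q XA [] ; LB = suc N ∷ pairUp q XB [] ; LC = pairUp q XC [ q ] in
  IsArrangement (nE (Spider (length LA) (length LB) (length LC))) (LA ++ LB ++ LC)
oddPairs-arrangement q N XA XB XC q≡ |X|≡N inner covered = spider-arrangement LA LB LC
  (trans (cong₂ _+_ (length-pairUp q XA []) (cong₂ _+_ (cong suc (length-pairUp q XB [])) (length-pairUp q XC [ q ])))
         (trans (size (length XA) (length XB) (length XC)) (trans (cong (λ n → suc (suc (n + n))) |X|≡N) (sym q≡))))
  (++⁺ (pairUp-bounded (++⁻ˡ XA inner) [])
       (++⁺ ((s≤s z≤n , N+1≤q) ∷ pairUp-bounded (++⁻ˡ XB (++⁻ʳ XA inner)) [])
            (pairUp-bounded (++⁻ʳ XB (++⁻ʳ XA inner)) ((≤-trans (s≤s z≤n) N+1≤q , ≤-refl) ∷ []))))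
  (arrangement-complete (≤-trans (n≤1+n N) N+1≤q)
    (PairsIn-++ {XA = XA} {XB} {XC} (∈-pairUp q []) (λ x∈ → let p , p′ = ∈-pairUp q [] x∈ in there p , there p′)
                (∈-pairUp q [ q ]))
    covered middle
    (∈-++⁺ʳ LA (∈-++⁺ʳ LB (∈-pairUp-tail q XC (here refl)))))
  where
  LA LB LC : List ℕ
  LA = pairUp q XA []
  LB = suc N ∷ pairUp q XB []
  LC = pairUp q XC [ q ]
  size : ∀ a b c → a * 2 + 0 + (suc (b * 2 + 0) + (c * 2 + 1)) ≡ suc (suc (a + b + c + (a + b + c)))
  size = solve-∀
  N+1≤q : suc N ≤ q
  N+1≤q = subst (suc N ≤_) (sym q≡) (s≤s (≤-trans (m≤m+n N N) (n≤1+n _)))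
  q∸N≡ : q ∸ N ≡ suc (suc N)
  q∸N≡ = trans (cong (_∸ N) (trans q≡ (cong suc (sym (+-suc N N))))) (trans (cong (_∸ N) (sym (+-suc N (suc N)))) (m+n∸m≡n N (suc (suc N))))
  middle : ∀ {y} → N < y → y < q ∸ N → y ∈ LA ++ LB ++ LC
  middle {y} N<y y<q∸N = ∈-++⁺ʳ LA (here (≤-antisym (≤-pred (subst (y <_) q∸N≡ y<q∸N)) N<y))

evenPairSpider : ∀ q N xA xsA xB xsB xC xsC → let XA = xA ∷ xsA ; XB = xB ∷ xsB ; XC = xC ∷ xsC in
  q ≡ suc (N + N) → length XA + length XB + length XC ≡ N →
  StepsDown XA → StepsDown XB → StepsDown XC → All (Inner q) (XA ++ XB ++ XC) →
  xA + (xB + xC) ≡ q ∸ 1 → final XA ≡ 1 → final XC ≡ 2 →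
  Covers (PairCovered q (XA ++ XB ++ XC)) 1 (suc N) →
  ChiLaEq (Spider (length XA * 2) (length XB * 2 + 1) (length XC * 2)) 4
evenPairSpider q N xA xsA xB xsB xC xsC q≡ |X|≡N stepsA stepsB stepsC inner core≡ finalA≡1 finalC≡2 covered =
  ChiLaEq-Spider (trans (length-pairUp q XA []) (+-identityʳ _)) (length-pairUp q XB [ q ])
                 (trans (length-pairUp q XC []) (+-identityʳ _))
    (spider-χla≡4 LA LB LC cs (s≤s (s≤s z≤n)) (s≤s (s≤s z≤n)) (s≤s (s≤s z≤n))
      (evenPairs-arrangement q N XA XB XC q≡ |X|≡N inner covered)
      (legSums-pairUp-distinct q xA xsA [] 1≤q core≢q stepsA innerA (leaf-distinct 1≤q (proj₁ (All-final innerA))))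
      (legSums-pairUp-distinct q xB xsB [ q ] 1≤q core≢q stepsB innerB (pendant-distinct (proj₂ (All-final innerB))))
      (legSums-pairUp-distinct q xC xsC [] 1≤q core≢q stepsC innerC (leaf-distinct 1≤q (proj₁ (All-final innerC))))
      (four-colours-unique (<⇒≤ 2<q) q<Z) refl
      (∈-∷⁺ʳ (subst (_∈ cs) (sym core≡) q∸1∈) (++-⊆ sumsA⊆ (++-⊆ sumsB⊆ sumsC⊆)))
      (∈-∷⁺ʳ (legSums-A⊆ LA LB LC (q∈legSums-pairUp q xA xsA [] (<⇒≤ (proj₂ (All.head innerA)))))
        (∈-∷⁺ʳ (here (sym core≡))
          (∈-∷⁺ʳ (legSums-C⊆ LA LB LC (subst (λ ℓ → q ∸ ℓ ∈ legSums LC) finalC≡2 (legSums-pairUp-tail-⊆ q xC xsC [] (here refl))))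
            (∈-∷⁺ʳ (legSums-B⊆ LA LB LC (legSums-pairUp-tail-⊆ q xB xsB [ q ] (here refl))) (λ ()))))))
  where
  XA XB XC LA LB LC : List ℕ
  XA = xA ∷ xsA
  XB = xB ∷ xsB
  XC = xC ∷ xsC
  LA = pairUp q XA []
  LB = pairUp q XB [ q ]
  LC = pairUp q XC []
  innerA : All (Inner q) XA
  innerA = ++⁻ˡ XA inner
  innerB : All (Inner q) XB
  innerB = ++⁻ˡ XB (++⁻ʳ XA inner)
  innerC : All (Inner q) XC
  innerC = ++⁻ʳ XB (++⁻ʳ XA inner)
  2<q : 2 < q
  2<q = subst (_< q) finalC≡2 (proj₂ (All-final innerC))
  1≤q : 1 ≤ q
  1≤q = ≤-trans (s≤s z≤n) (<⇒≤ 2<q)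
  core≢q : xA + (xB + xC) ≢ q
  core≢q = subst (_≢ q) (sym core≡) (<⇒≢ (∸-< 1≤q (s≤s z≤n)))
  Z : ℕ
  Z = q ∸ final XB + q
  q<Z : q < Z
  q<Z = m<n+m q (m<n⇒0<n∸m (proj₂ (All-final innerB)))
  cs : List ℕ
  cs = q ∷ q ∸ 1 ∷ q ∸ 2 ∷ Z ∷ []
  q∈ : q ∈ cs
  q∈ = here refl
  q∸1∈ : q ∸ 1 ∈ cs
  q∸1∈ = there (here refl)
  q∸2∈ : q ∸ 2 ∈ cs
  q∸2∈ = there (there (here refl))
  sumsA⊆ : legSums LA ⊆ cs
  sumsA⊆ = legSums-pairUp-⊆ q xA xsA [] q∈ q∸1∈ q∸2∈ stepsA innerA
    (∈-∷⁺ʳ (subst (λ ℓ → q ∸ ℓ ∈ cs) (sym finalA≡1) q∸1∈) (λ ()))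
  sumsB⊆ : legSums LB ⊆ cs
  sumsB⊆ = legSums-pairUp-⊆ q xB xsB [ q ] q∈ q∸1∈ q∸2∈ stepsB innerB
    (∈-∷⁺ʳ (there (there (there (here refl)))) (∈-∷⁺ʳ q∈ (λ ())))
  sumsC⊆ : legSums LC ⊆ cs
  sumsC⊆ = legSums-pairUp-⊆ q xC xsC [] q∈ q∸1∈ q∸2∈ stepsC innerC
    (∈-∷⁺ʳ (subst (λ ℓ → q ∸ ℓ ∈ cs) (sym finalC≡2) q∸2∈) (λ ()))
oddPairSpider : ∀ q N xA xsA xB xsB xC xsC → let XA = xA ∷ xsA ; XB = xB ∷ xsB ; XC = xC ∷ xsC in
  q ≡ suc (suc (N + N)) → length XA + length XB + length XC ≡ N →
  StepsDown XA → StepsDown XB → StepsDown XC → All (Inner q) (XA ++ XB ++ XC) →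
  xB ≡ N → xA + (suc N + xC) ≡ q ∸ final XC + q →
  (final XA ≡ 1 × final XB ≡ 2) ⊎ (final XA ≡ 2 × final XB ≡ 1) →
  Covers (PairCovered q (XA ++ XB ++ XC)) 1 (suc N) →
  ChiLaEq (Spider (length XA * 2) (suc (length XB * 2)) (length XC * 2 + 1)) 4
oddPairSpider q N xA xsA xB xsB xC xsC q≡ |X|≡N stepsA stepsB stepsC inner xB≡N core≡ finals covered =
  ChiLaEq-Spider (trans (length-pairUp q XA []) (+-identityʳ _)) (cong suc (trans (length-pairUp q XB []) (+-identityʳ _)))
                 (length-pairUp q XC [ q ])
    (spider-χla≡4 LA LB LC cs (s≤s (s≤s z≤n)) (s≤s (s≤s z≤n)) (s≤s (s≤s z≤n))
      (oddPairs-arrangement q N XA XB XC q≡ |X|≡N inner covered)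
      (legSums-pairUp-distinct q xA xsA [] 1≤q core≢q stepsA innerA (leaf-distinct 1≤q (proj₁ (All-final innerA))))
      (subst (_≢ suc N + xB) (sym core≡) (>⇒≢ (<-trans (subst (_< q) (sym y₀+xB≡) (∸-< 1≤q (s≤s z≤n))) q<Z))
       ∷ legSums-pairUp-distinct q xB xsB [] 1≤q (subst (_≢ q) (sym y₀+xB≡) (<⇒≢ (∸-< 1≤q (s≤s z≤n)))) stepsB innerB
           (leaf-distinct 1≤q (proj₁ (All-final innerB))))
      (legSums-pairUp-distinct q xC xsC [ q ] 1≤q core≢q stepsC innerC (pendant-distinct (proj₂ (All-final innerC))))
      (four-colours-unique 2≤q q<Z) refl
      (∈-∷⁺ʳ (subst (_∈ cs) (sym core≡) Z∈) (++-⊆ sumsA⊆ (++-⊆ sumsB⊆ sumsC⊆)))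
      (∈-∷⁺ʳ (legSums-A⊆ LA LB LC (q∈legSums-pairUp q xA xsA [] (<⇒≤ (proj₂ (All.head innerA)))))
        (∈-∷⁺ʳ (legSums-B⊆ LA LB LC (here (sym y₀+xB≡)))
          (∈-∷⁺ʳ (q∸2∈sums finals) (∈-∷⁺ʳ (here (sym core≡)) (λ ()))))))
  where
  XA XB XC LA LB LC : List ℕ
  XA = xA ∷ xsA
  XB = xB ∷ xsB
  XC = xC ∷ xsC
  LA = pairUp q XA []
  LB = suc N ∷ pairUp q XB []
  LC = pairUp q XC [ q ]
  innerA : All (Inner q) XA
  innerA = ++⁻ˡ XA inner
  innerB : All (Inner q) XB
  innerB = ++⁻ˡ XB (++⁻ʳ XA inner)
  innerC : All (Inner q) XC
  innerC = ++⁻ʳ XB (++⁻ʳ XA inner)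
  2≤q : 2 ≤ q
  2≤q = subst (2 ≤_) (sym q≡) (s≤s (s≤s z≤n))
  1≤q : 1 ≤ q
  1≤q = ≤-trans (s≤s z≤n) 2≤q
  y₀+xB≡ : suc N + xB ≡ q ∸ 1
  y₀+xB≡ = trans (cong (suc N +_) xB≡N) (sym (cong (_∸ 1) q≡))
  Z : ℕ
  Z = q ∸ final XC + q
  q<Z : q < Z
  q<Z = m<n+m q (m<n⇒0<n∸m (proj₂ (All-final innerC)))
  core≢q : xA + (suc N + xC) ≢ q
  core≢q = subst (_≢ q) (sym core≡) (>⇒≢ q<Z)
  cs : List ℕ
  cs = q ∷ q ∸ 1 ∷ q ∸ 2 ∷ Z ∷ []
  q∈ : q ∈ cs
  q∈ = here refl
  q∸1∈ : q ∸ 1 ∈ cs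
  q∸1∈ = there (here refl)
  q∸2∈ : q ∸ 2 ∈ cs
  q∸2∈ = there (there (here refl))
  Z∈ : Z ∈ cs
  Z∈ = there (there (there (here refl)))
  q∸1or2∈ : ∀ {ℓ} → ℓ ≡ 1 ⊎ ℓ ≡ 2 → q ∸ ℓ ∈ cs
  q∸1or2∈ (inj₁ refl) = q∸1∈
  q∸1or2∈ (inj₂ refl) = q∸2∈
  finalA : final XA ≡ 1 ⊎ final XA ≡ 2
  finalA = Data.Sum.map proj₁ proj₁ finals
  finalB : final XB ≡ 1 ⊎ final XB ≡ 2
  finalB = Data.Sum.swap (Data.Sum.map proj₂ proj₂ finals)
  sumsA⊆ : legSums LA ⊆ cs
  sumsA⊆ = legSums-pairUp-⊆ q xA xsA [] q∈ q∸1∈ q∸2∈ stepsA innerA (∈-∷⁺ʳ (q∸1or2∈ finalA) (λ ()))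
  sumsB⊆ : legSums LB ⊆ cs
  sumsB⊆ = ∈-∷⁺ʳ (subst (_∈ cs) (sym y₀+xB≡) q∸1∈)
    (legSums-pairUp-⊆ q xB xsB [] q∈ q∸1∈ q∸2∈ stepsB innerB (∈-∷⁺ʳ (q∸1or2∈ finalB) (λ ())))
  sumsC⊆ : legSums LC ⊆ cs
  sumsC⊆ = legSums-pairUp-⊆ q xC xsC [ q ] q∈ q∸1∈ q∸2∈ stepsC innerC (∈-∷⁺ʳ Z∈ (∈-∷⁺ʳ q∈ (λ ())))
  q∸2∈sums : (final XA ≡ 1 × final XB ≡ 2) ⊎ (final XA ≡ 2 × final XB ≡ 1) → q ∸ 2 ∈ spiderSums LA LB LC
  q∸2∈sums (inj₁ (_ , finalB≡2)) = legSums-B⊆ LA LB LC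
    (there (subst (λ ℓ → q ∸ ℓ ∈ legSums (pairUp q XB [])) finalB≡2 (legSums-pairUp-tail-⊆ q xB xsB [] (here refl))))
  q∸2∈sums (inj₂ (finalA≡2 , _)) = legSums-A⊆ LA LB LC
    (subst (λ ℓ → q ∸ ℓ ∈ legSums LA) finalA≡2 (legSums-pairUp-tail-⊆ q xA xsA [] (here refl)))

-- The four families

-- The ring-solver identities below quantify over the module parameters, which solve-∀ cannot treat
-- as constants.

≤-from-sum : ∀ {a q} c → a + c ≡ q → a ≤ q
≤-from-sum {a} c refl = m≤m+n a c

-- The case l = 2h with h ≥ n, parametrised by n = n₁ + 1, h = n + d and m = h + t.
module EvenThirdLegLong (n₁ d t : ℕ) where
  n h s₀ N q : ℕ
  n = suc n₁
  h = n + d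
  s₀ = n * 2 + h * 2
  N = s₀ + t
  q = suc (N + N)
  seg₁ seg₂ seg₃ XA XB XC X : List ℕ
  seg₁ = descAP (suc s₀) 2 (suc t)
  seg₂ = descAP (h * 2 + 1) 1 (suc (n₁ * 2))
  seg₃ = descAP (suc (n * 2)) 2 d
  XA = descAP 1 2 n
  XB = seg₁ ++ seg₂ ++ seg₃
  XC = descAP 2 2 h
  X = XA ++ XB ++ XC

  |XB|≡ : length XB ≡ suc t + (suc (n₁ * 2) + d)
  |XB|≡ = trans (length-++ seg₁) (cong₂ _+_ (length-descAP _ 2 (suc t))
            (trans (length-++ seg₂) (cong₂ _+_ (length-descAP _ 1 (suc (n₁ * 2))) (length-descAP _ 2 d))))
  lengthB : ∀ n₁ d t → (suc t + (suc (n₁ * 2) + d)) * 2 + 1 ≡ 2 * suc n₁ + 2 * (suc n₁ + d + t) + 1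
  lengthB = solve-∀
  total : ∀ n₁ d t → suc n₁ + (suc t + (suc (n₁ * 2) + d)) + (suc n₁ + d) ≡ suc n₁ * 2 + (suc n₁ + d) * 2 + t
  total = solve-∀
  |X|≡N : length XA + length XB + length XC ≡ N
  |X|≡N = trans (cong₂ _+_ (cong₂ _+_ (length-descAP 1 2 n) |XB|≡) (length-descAP 2 2 h)) (total n₁ d t)

  join₁ : ∀ n₁ d → suc (suc n₁ * 2 + (suc n₁ + d) * 2) ≡ 2 + ((n₁ * 2) * 1 + ((suc n₁ + d) * 2 + 1))
  join₁ = solve-∀
  join₂₃ : ∀ d → Joins (descAP ((suc n₁ + d) * 2 + 1) 1 (suc (n₁ * 2))) (descAP (suc (suc n₁ * 2)) 2 d)
  join₂₃ zero     = tt
  join₂₃ (suc d₁) = inj₂ (trans (final-descAP _ 1 (n₁ * 2)) (identity n₁ d₁))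
    where
    identity : ∀ n₁ d₁ → (suc n₁ + suc d₁) * 2 + 1 ≡ 2 + (d₁ * 2 + suc (suc n₁ * 2))
    identity = solve-∀
  stepsB : StepsDown XB
  stepsB = StepsDown-++ seg₁ (seg₂ ++ seg₃) (descAP₂-steps (suc s₀) (suc t))
    (StepsDown-++ seg₂ seg₃ (descAP₁-steps _ (suc (n₁ * 2))) (descAP₂-steps _ d) (join₂₃ d))
    (inj₂ (trans (final-descAP (suc s₀) 2 t) (join₁ n₁ d)))

  A-fits : ∀ n₁ d t → let n = suc n₁ ; h = n + d ; N = n * 2 + h * 2 + t in
    n * 2 + 1 + (n * 2 + h * 4 + t * 2) ≡ suc (N + N)
  A-fits = solve-∀
  seg₁-fits : ∀ n₁ d t → let n = suc n₁ ; h = n + d ; N = n * 2 + h * 2 + t in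
    suc t * 2 + suc (n * 2 + h * 2) + (n₁ * 2 + h * 2) ≡ suc (N + N)
  seg₁-fits = solve-∀
  seg₂-fits : ∀ n₁ d t → let n = suc n₁ ; h = n + d ; N = n * 2 + h * 2 + t in
    suc (n₁ * 2) * 1 + (h * 2 + 1) + (n * 2 + h * 2 + t * 2 + 1) ≡ suc (N + N)
  seg₂-fits = solve-∀
  seg₃-fits : ∀ n₁ d t → let n = suc n₁ ; h = n + d ; N = n * 2 + h * 2 + t in
    d * 2 + suc (n * 2) + (n * 4 + h * 2 + t * 2) ≡ suc (N + N)
  seg₃-fits = solve-∀
  C-fits : ∀ n₁ d t → let n = suc n₁ ; h = n + d ; N = n * 2 + h * 2 + t in
    h * 2 + 2 + (n₁ * 4 + 3 + h * 2 + t * 2) ≡ suc (N + N)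
  C-fits = solve-∀
  inner : All (Inner q) X
  inner = ++⁺ (descAP-inner 1 2 n (s≤s z≤n) (s≤s z≤n) (≤-from-sum _ (A-fits n₁ d t)))
         (++⁺ (++⁺ (descAP-inner (suc s₀) 2 (suc t) (s≤s z≤n) (s≤s z≤n) (≤-from-sum _ (seg₁-fits n₁ d t)))
              (++⁺ (descAP-inner (h * 2 + 1) 1 (suc (n₁ * 2)) (s≤s z≤n) (s≤s z≤n) (≤-from-sum _ (seg₂-fits n₁ d t)))
                   (descAP-inner (suc (n * 2)) 2 d (s≤s z≤n) (s≤s z≤n) (≤-from-sum _ (seg₃-fits n₁ d t)))))
              (descAP-inner 2 2 h (s≤s z≤n) (s≤s z≤n) (≤-from-sum _ (C-fits n₁ d t))))

  core : ∀ n₁ d t → let n = suc n₁ ; h = n + d ; N = n * 2 + h * 2 + t in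
    n₁ * 2 + 1 + (t * 2 + suc (n * 2 + h * 2) + ((n₁ + d) * 2 + 2)) ≡ N + N
  core = solve-∀

  P : ℕ → Set
  P = PairCovered q X
  in-A : ∀ {s} → s ∈ XA → P s
  in-A = inj₁ ∘ ∈-++⁺ˡ
  in-B : ∀ {s} → s ∈ XB → P s
  in-B = inj₁ ∘ ∈-++⁺ʳ XA ∘ ∈-++⁺ˡ
  in-C : ∀ {s} → s ∈ XC → P s
  in-C = inj₁ ∘ ∈-++⁺ʳ XA ∘ ∈-++⁺ʳ XB
  mirror : ∀ n₁ d t → let n = suc n₁ ; h = n + d ; s₀ = n * 2 + h * 2 ; N = s₀ + t in
    suc (N + N) ≡ t * 2 + s₀ + suc s₀
  mirror = solve-∀
  start₃ : ∀ n₁ d → (suc n₁ + d) * 2 + 1 ≡ d * 2 + suc (suc n₁ * 2)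
  start₃ = solve-∀
  start₄ : ∀ n₁ d → suc n₁ * 2 + (suc n₁ + d) * 2 ≡ suc (n₁ * 2) * 1 + ((suc n₁ + d) * 2 + 1)
  start₄ = solve-∀
  end₄ : ∀ s₀ t → suc (s₀ + t) + suc t ≡ suc t * 2 + s₀
  end₄ = solve-∀
  covered : Covers P 1 (suc N)
  covered = covers-shrink (≤-from-sum (suc t) (end₄ s₀ t))
    (covers-join (≤-reflexive (+-comm 1 (n * 2)))
      (covers-descAP₂ 1 n in-A (in-C ∘ descAP-lower⊆ 2 2 n d))
    (covers-join (≤-reflexive (start₃ n₁ d))
      (covers-descAP₂ (suc (n * 2)) d (in-B ∘ ∈-++⁺ʳ seg₁ ∘ ∈-++⁺ʳ seg₂) (in-C ∘ descAP-upper⊆ 2 2 n d))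
    (covers-join (≤-reflexive (start₄ n₁ d))
      (covers-descAP₁ (h * 2 + 1) (suc (n₁ * 2)) (in-B ∘ ∈-++⁺ʳ seg₁ ∘ ∈-++⁺ˡ))
      (covers-descAP₂ s₀ (suc t) (inj₂ ∘ ∈-++⁺ʳ XA ∘ ∈-++⁺ˡ ∘ ∈-++⁺ˡ ∘ descAP-mirror (mirror n₁ d t)) (in-B ∘ ∈-++⁺ˡ)))))

  χla : ChiLaEq (Spider (2 * n) (2 * n + 2 * (h + t) + 1) (2 * h)) 4
  χla =
    ChiLaEq-Spider (trans (cong (_* 2) (length-descAP 1 2 n)) (*-comm n 2))
                   (trans (cong (λ k → k * 2 + 1) |XB|≡) (lengthB n₁ d t))
                   (trans (cong (_* 2) (length-descAP 2 2 h)) (*-comm h 2))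
      (evenPairSpider q N _ _ _ _ _ _ refl |X|≡N (descAP₂-steps 1 n) stepsB (descAP₂-steps 2 h) inner
         (core n₁ d t) (final-descAP 1 2 n₁) (final-descAP 2 2 (n₁ + d)) covered)

-- The case l = 2h with h < n, parametrised by h = h₁ + 1, n = h + d + 1 and m = h + t.
module EvenThirdLegShort (h₁ d t : ℕ) where
  h n s₀ N q : ℕ
  h = suc h₁
  n = h + suc d
  s₀ = n * 2 + h * 2
  N = s₀ + t
  q = suc (N + N)
  seg₁ seg₂ seg₃ XA XB XC X : List ℕ
  seg₁ = descAP (suc s₀) 2 (suc t)
  seg₂ = descAP (n * 2 + 1) 1 (suc (h₁ * 2))
  seg₃ = descAP (suc (suc (h * 2))) 2 (suc d)
  XA = descAP 1 2 n
  XB = seg₁ ++ seg₂ ++ seg₃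
  XC = descAP 2 2 h
  X = XA ++ XB ++ XC

  |XB|≡ : length XB ≡ suc t + (suc (h₁ * 2) + suc d)
  |XB|≡ = trans (length-++ seg₁) (cong₂ _+_ (length-descAP _ 2 (suc t))
            (trans (length-++ seg₂) (cong₂ _+_ (length-descAP _ 1 (suc (h₁ * 2))) (length-descAP _ 2 (suc d)))))
  lengthB : ∀ h₁ d t → (suc t + (suc (h₁ * 2) + suc d)) * 2 + 1 ≡ 2 * (suc h₁ + suc d) + 2 * (suc h₁ + t) + 1
  lengthB = solve-∀
  total : ∀ h₁ d t → suc h₁ + suc d + (suc t + (suc (h₁ * 2) + suc d)) + suc h₁ ≡ (suc h₁ + suc d) * 2 + suc h₁ * 2 + t
  total = solve-∀
  |X|≡N : length XA + length XB + length XC ≡ N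
  |X|≡N = trans (cong₂ _+_ (cong₂ _+_ (length-descAP 1 2 n) |XB|≡) (length-descAP 2 2 h)) (total h₁ d t)

  join₁ : ∀ h₁ d → suc ((suc h₁ + suc d) * 2 + suc h₁ * 2) ≡ 2 + ((h₁ * 2) * 1 + ((suc h₁ + suc d) * 2 + 1))
  join₁ = solve-∀
  join₂ : ∀ h₁ d → (suc h₁ + suc d) * 2 + 1 ≡ 1 + (d * 2 + suc (suc (suc h₁ * 2)))
  join₂ = solve-∀
  stepsB : StepsDown XB
  stepsB = StepsDown-++ seg₁ (seg₂ ++ seg₃) (descAP₂-steps (suc s₀) (suc t))
    (StepsDown-++ seg₂ seg₃ (descAP₁-steps _ (suc (h₁ * 2))) (descAP₂-steps _ (suc d))
      (inj₁ (trans (final-descAP (n * 2 + 1) 1 (h₁ * 2)) (join₂ h₁ d))))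
    (inj₂ (trans (final-descAP (suc s₀) 2 t) (join₁ h₁ d)))

  A-fits : ∀ h₁ d t → let h = suc h₁ ; n = h + suc d ; N = n * 2 + h * 2 + t in
    n * 2 + 1 + (n * 2 + h * 4 + t * 2) ≡ suc (N + N)
  A-fits = solve-∀
  seg₁-fits : ∀ h₁ d t → let h = suc h₁ ; n = h + suc d ; N = n * 2 + h * 2 + t in
    suc t * 2 + suc (n * 2 + h * 2) + (n * 2 + h₁ * 2) ≡ suc (N + N)
  seg₁-fits = solve-∀
  seg₂-fits : ∀ h₁ d t → let h = suc h₁ ; n = h + suc d ; N = n * 2 + h * 2 + t in
    suc (h₁ * 2) * 1 + (n * 2 + 1) + (n * 2 + h * 2 + t * 2 + 1) ≡ suc (N + N)
  seg₂-fits = solve-∀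
  seg₃-fits : ∀ h₁ d t → let h = suc h₁ ; n = h + suc d ; N = n * 2 + h * 2 + t in
    suc d * 2 + suc (suc (h * 2)) + (n * 2 + h₁ * 4 + 3 + t * 2) ≡ suc (N + N)
  seg₃-fits = solve-∀
  C-fits : ∀ h₁ d t → let h = suc h₁ ; n = h + suc d ; N = n * 2 + h * 2 + t in
    h * 2 + 2 + (n * 4 + h₁ * 2 + 1 + t * 2) ≡ suc (N + N)
  C-fits = solve-∀
  inner : All (Inner q) X
  inner = ++⁺ (descAP-inner 1 2 n (s≤s z≤n) (s≤s z≤n) (≤-from-sum _ (A-fits h₁ d t)))
         (++⁺ (++⁺ (descAP-inner (suc s₀) 2 (suc t) (s≤s z≤n) (s≤s z≤n) (≤-from-sum _ (seg₁-fits h₁ d t)))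
              (++⁺ (descAP-inner (n * 2 + 1) 1 (suc (h₁ * 2)) (s≤s z≤n) (s≤s z≤n) (≤-from-sum _ (seg₂-fits h₁ d t)))
                   (descAP-inner (suc (suc (h * 2))) 2 (suc d) (s≤s z≤n) (s≤s z≤n) (≤-from-sum _ (seg₃-fits h₁ d t)))))
              (descAP-inner 2 2 h (s≤s z≤n) (s≤s z≤n) (≤-from-sum _ (C-fits h₁ d t))))

  core : ∀ h₁ d t → let h = suc h₁ ; n = h + suc d ; N = n * 2 + h * 2 + t in
    (h₁ + suc d) * 2 + 1 + (t * 2 + suc (n * 2 + h * 2) + (h₁ * 2 + 2)) ≡ N + N
  core = solve-∀

  P : ℕ → Set
  P = PairCovered q X
  in-A : ∀ {s} → s ∈ XA → P s
  in-A = inj₁ ∘ ∈-++⁺ˡ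
  in-B : ∀ {s} → s ∈ XB → P s
  in-B = inj₁ ∘ ∈-++⁺ʳ XA ∘ ∈-++⁺ˡ
  in-C : ∀ {s} → s ∈ XC → P s
  in-C = inj₁ ∘ ∈-++⁺ʳ XA ∘ ∈-++⁺ʳ XB
  mirror : ∀ h₁ d t → let h = suc h₁ ; n = h + suc d ; s₀ = n * 2 + h * 2 ; N = s₀ + t in
    suc (N + N) ≡ t * 2 + s₀ + suc s₀
  mirror = solve-∀
  start₃ : ∀ h₁ d → (suc h₁ + suc d) * 2 + 1 ≡ suc d * 2 + suc (suc h₁ * 2)
  start₃ = solve-∀
  start₄ : ∀ h₁ d → (suc h₁ + suc d) * 2 + suc h₁ * 2 ≡ suc (h₁ * 2) * 1 + ((suc h₁ + suc d) * 2 + 1)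
  start₄ = solve-∀
  end₄ : ∀ s₀ t → suc (s₀ + t) + suc t ≡ suc t * 2 + s₀
  end₄ = solve-∀
  covered : Covers P 1 (suc N)
  covered = covers-shrink (≤-from-sum (suc t) (end₄ s₀ t))
    (covers-join (≤-reflexive (+-comm 1 (h * 2)))
      (covers-descAP₂ 1 h (in-A ∘ descAP-lower⊆ 1 2 h (suc d)) in-C)
    (covers-join (≤-reflexive (start₃ h₁ d))
      (covers-descAP₂ (suc (h * 2)) (suc d) (in-A ∘ descAP-upper⊆ 1 2 h (suc d)) (in-B ∘ ∈-++⁺ʳ seg₁ ∘ ∈-++⁺ʳ seg₂))
    (covers-join (≤-reflexive (start₄ h₁ d))
      (covers-descAP₁ (n * 2 + 1) (suc (h₁ * 2)) (in-B ∘ ∈-++⁺ʳ seg₁ ∘ ∈-++⁺ˡ))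
      (covers-descAP₂ s₀ (suc t) (inj₂ ∘ ∈-++⁺ʳ XA ∘ ∈-++⁺ˡ ∘ ∈-++⁺ˡ ∘ descAP-mirror (mirror h₁ d t)) (in-B ∘ ∈-++⁺ˡ)))))

  χla : ChiLaEq (Spider (2 * n) (2 * n + 2 * (h + t) + 1) (2 * h)) 4
  χla =
    ChiLaEq-Spider (trans (cong (_* 2) (length-descAP 1 2 n)) (*-comm n 2))
                   (trans (cong (λ k → k * 2 + 1) |XB|≡) (lengthB h₁ d t))
                   (trans (cong (_* 2) (length-descAP 2 2 h)) (*-comm h 2))
      (evenPairSpider q N _ _ _ _ _ _ refl |X|≡N (descAP₂-steps 1 n) stepsB (descAP₂-steps 2 h) inner
         (core h₁ d t) (final-descAP 1 2 (h₁ + suc d)) (final-descAP 2 2 h₁) covered)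

-- The case l = 2j + 1 with m − j even, parametrised by n = n₁ + 1, j = j₁ + 1 and m = j + 2u.
module OddThirdLegEvenGap (n₁ j₁ u : ℕ) where
  n j N q b₁ cb : ℕ
  n = suc n₁
  j = suc j₁
  N = n * 2 + u * 2 + j * 2
  q = suc (suc (N + N))
  b₁ = n * 2 + u + j * 2
  cb = n * 2 + u * 3 + j * 2 + 3
  seg₁ seg₂ seg₃ seg₄ XA XB XC X : List ℕ
  seg₁ = descAP b₁ 1 (suc u)
  seg₂ = descAP (n * 2 + u) 2 j
  seg₃ = descAP (n * 2) 1 u
  seg₄ = descAP 2 2 n₁
  XA = descAP 1 2 n
  XB = seg₁ ++ seg₂ ++ seg₃ ++ seg₄
  XC = descAP cb 2 j
  X = XA ++ XB ++ XC

  |XB|≡ : length XB ≡ suc u + (j + (u + n₁))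
  |XB|≡ = trans (length-++ seg₁) (cong₂ _+_ (length-descAP b₁ 1 (suc u))
            (trans (length-++ seg₂) (cong₂ _+_ (length-descAP _ 2 j)
              (trans (length-++ seg₃) (cong₂ _+_ (length-descAP _ 1 u) (length-descAP 2 2 n₁))))))
  lengthB : ∀ n₁ j₁ u → suc ((suc u + (suc j₁ + (u + n₁))) * 2) ≡ 2 * suc n₁ + 2 * (suc j₁ + 2 * u) + 1
  lengthB = solve-∀
  total : ∀ n₁ j₁ u → suc n₁ + (suc u + (suc j₁ + (u + n₁))) + suc j₁ ≡ suc n₁ * 2 + u * 2 + suc j₁ * 2
  total = solve-∀
  |X|≡N : length XA + length XB + length XC ≡ N
  |X|≡N = trans (cong₂ _+_ (cong₂ _+_ (length-descAP 1 2 n) |XB|≡) (length-descAP cb 2 j)) (total n₁ j₁ u)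

  join₁ : ∀ n₁ j₁ u → suc n₁ * 2 + u + suc j₁ * 2 ≡ 2 + (j₁ * 2 + (suc n₁ * 2 + u))
  join₁ = solve-∀
  join₂ : ∀ n₁ u → Joins (descAP (suc n₁ * 2 + u) 2 j) (descAP (suc n₁ * 2) 1 u ++ descAP 2 2 n₁)
  join₂ n₁       (suc u₁) = inj₁ (trans (final-descAP _ 2 j₁) (identity n₁ u₁))
    where
    identity : ∀ n₁ u₁ → suc n₁ * 2 + suc u₁ ≡ 1 + (u₁ * 1 + suc n₁ * 2)
    identity = solve-∀
  join₂ zero     zero     = tt
  join₂ (suc n₂) zero     = inj₂ (trans (final-descAP _ 2 j₁) (identity n₂))
    where
    identity : ∀ n₂ → suc (suc n₂) * 2 + 0 ≡ 2 + (n₂ * 2 + 2)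
    identity = solve-∀
  join₃ : ∀ n₁ u → Joins (descAP (suc n₁ * 2) 1 u) (descAP 2 2 n₁)
  join₃ n₁       zero     = tt
  join₃ zero     (suc u₁) = tt
  join₃ (suc n₂) (suc u₁) = inj₂ (trans (final-descAP _ 1 u₁) (identity n₂))
    where
    identity : ∀ n₂ → suc (suc n₂) * 2 ≡ 2 + (n₂ * 2 + 2)
    identity = solve-∀
  stepsB : StepsDown XB
  stepsB = StepsDown-++ seg₁ (seg₂ ++ seg₃ ++ seg₄) (descAP₁-steps b₁ (suc u))
    (StepsDown-++ seg₂ (seg₃ ++ seg₄) (descAP₂-steps _ j)
      (StepsDown-++ seg₃ seg₄ (descAP₁-steps _ u) (descAP₂-steps 2 n₁) (join₃ n₁ u)) (join₂ n₁ u))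
    (inj₂ (trans (final-descAP b₁ 1 u) (join₁ n₁ j₁ u)))

  finalB : ∀ n₁ u → final (descAP (suc n₁ * 2 + u) 2 j ++ descAP (suc n₁ * 2) 1 u ++ descAP 2 2 n₁) ≡ 2
  finalB (suc n₂) u = trans (cong final (sym (++-assoc (descAP (suc (suc n₂) * 2 + u) 2 j) (descAP (suc (suc n₂) * 2) 1 u) _)))
                            (trans (final-++ (descAP (suc (suc n₂) * 2 + u) 2 j ++ descAP (suc (suc n₂) * 2) 1 u) _ _)
                                   (final-descAP 2 2 n₂))
  finalB zero (suc u₁) = trans (final-++ (descAP (2 + suc u₁) 2 j) _ _)
                               (trans (cong final (++-identityʳ (descAP 2 1 (suc u₁)))) (final-descAP 2 1 u₁))
  finalB zero zero = trans (cong final (++-identityʳ (descAP 2 2 j))) (final-descAP 2 2 j₁)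
  finalB≡2 : final XB ≡ 2
  finalB≡2 = trans (final-++ seg₁ _ _) (finalB n₁ u)

  head-B : ∀ n₁ j₁ u → u * 1 + (suc n₁ * 2 + u + suc j₁ * 2) ≡ suc n₁ * 2 + u * 2 + suc j₁ * 2
  head-B = solve-∀
  q≡ : ∀ n₁ j₁ u → let N = suc n₁ * 2 + u * 2 + suc j₁ * 2 in
    suc (suc (N + N)) ≡ (suc n₁ * 2 + u * 3 + suc j₁ * 2 + 3) + (suc n₁ * 2 + u + j₁ * 2 + 1)
  q≡ = solve-∀
  core : ∀ n₁ j₁ u → let N = suc n₁ * 2 + u * 2 + suc j₁ * 2 in
    n₁ * 2 + 1 + (suc N + (j₁ * 2 + (suc n₁ * 2 + u * 3 + suc j₁ * 2 + 3))) ≡ (suc n₁ * 2 + u + j₁ * 2 + 1) + suc (suc (N + N))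
  core = solve-∀
  core≡ : n₁ * 2 + 1 + (suc N + (j₁ * 2 + cb)) ≡ q ∸ final XC + q
  core≡ = trans (core n₁ j₁ u)
    (cong (_+ q) (sym (trans (cong (q ∸_) (final-descAP cb 2 j₁)) (trans (cong (_∸ cb) (q≡ n₁ j₁ u)) (m+n∸m≡n cb _)))))

  A-fits : ∀ n₁ j₁ u → let N = suc n₁ * 2 + u * 2 + suc j₁ * 2 in
    suc n₁ * 2 + 1 + (suc n₁ * 2 + u * 4 + suc j₁ * 4 + 1) ≡ suc (suc (N + N))
  A-fits = solve-∀
  seg₁-fits : ∀ n₁ j₁ u → let N = suc n₁ * 2 + u * 2 + suc j₁ * 2 in
    suc u * 1 + (suc n₁ * 2 + u + suc j₁ * 2) + suc N ≡ suc (suc (N + N))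
  seg₁-fits = solve-∀
  seg₂-fits : ∀ n₁ j₁ u → let N = suc n₁ * 2 + u * 2 + suc j₁ * 2 in
    suc j₁ * 2 + (suc n₁ * 2 + u) + (suc n₁ * 2 + u * 3 + suc j₁ * 2 + 2) ≡ suc (suc (N + N))
  seg₂-fits = solve-∀
  seg₃-fits : ∀ n₁ j₁ u → let N = suc n₁ * 2 + u * 2 + suc j₁ * 2 in
    u * 1 + suc n₁ * 2 + (suc n₁ * 2 + u * 3 + suc j₁ * 4 + 2) ≡ suc (suc (N + N))
  seg₃-fits = solve-∀
  seg₄-fits : ∀ n₁ j₁ u → let N = suc n₁ * 2 + u * 2 + suc j₁ * 2 in
    n₁ * 2 + 2 + (suc n₁ * 2 + u * 4 + suc j₁ * 4 + 2) ≡ suc (suc (N + N))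
  seg₄-fits = solve-∀
  C-fits : ∀ n₁ j₁ u → let N = suc n₁ * 2 + u * 2 + suc j₁ * 2 in
    suc j₁ * 2 + (suc n₁ * 2 + u * 3 + suc j₁ * 2 + 3) + (n₁ * 2 + u + 1) ≡ suc (suc (N + N))
  C-fits = solve-∀
  inner : All (Inner q) X
  inner = ++⁺ (descAP-inner 1 2 n (s≤s z≤n) (s≤s z≤n) (≤-from-sum _ (A-fits n₁ j₁ u)))
         (++⁺ (++⁺ (descAP-inner b₁ 1 (suc u) (s≤s z≤n) (s≤s z≤n) (≤-from-sum _ (seg₁-fits n₁ j₁ u)))
              (++⁺ (descAP-inner (n * 2 + u) 2 j (s≤s z≤n) (s≤s z≤n) (≤-from-sum _ (seg₂-fits n₁ j₁ u)))
              (++⁺ (descAP-inner (n * 2) 1 u (s≤s z≤n) (s≤s z≤n) (≤-from-sum _ (seg₃-fits n₁ j₁ u)))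
                   (descAP-inner 2 2 n₁ (s≤s z≤n) (s≤s z≤n) (≤-from-sum _ (seg₄-fits n₁ j₁ u))))))
              (descAP-inner cb 2 j (s≤s z≤n) (s≤s z≤n) (≤-from-sum _ (C-fits n₁ j₁ u))))

  P : ℕ → Set
  P = PairCovered q X
  in-A : ∀ {s} → s ∈ XA → P s
  in-A = inj₁ ∘ ∈-++⁺ˡ
  in-B : ∀ {s} → s ∈ XB → P s
  in-B = inj₁ ∘ ∈-++⁺ʳ XA ∘ ∈-++⁺ˡ
  -- The even label n * 2 ends seg₂ when u = 0 and seg₃ otherwise.
  double-n∈ : ∀ u → n₁ * 2 + 2 ∈ descAP (suc n₁ * 2 + u) 2 j ++ descAP (suc n₁ * 2) 1 u ++ seg₄
  double-n∈ zero     = ∈-++⁺ˡ (subst (_∈ descAP (suc n₁ * 2 + 0) 2 j) (identity n₁) (∈-descAP⁺ 0 (s≤s z≤n)))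
    where
    identity : ∀ n₁ → suc n₁ * 2 + 0 ≡ n₁ * 2 + 2
    identity = solve-∀
  double-n∈ (suc u₁) = ∈-++⁺ʳ (descAP (suc n₁ * 2 + suc u₁) 2 j)
    (∈-++⁺ˡ (subst (_∈ descAP (suc n₁ * 2) 1 (suc u₁)) (identity n₁) (∈-descAP⁺ 0 (s≤s z≤n))))
    where
    identity : ∀ n₁ → suc n₁ * 2 ≡ n₁ * 2 + 2
    identity = solve-∀
  evens-B : ∀ {s} → s ∈ descAP 2 2 n → P s
  evens-B (here refl) = in-B (∈-++⁺ʳ seg₁ (double-n∈ u))
  evens-B (there s∈)  = in-B (∈-++⁺ʳ seg₁ (∈-++⁺ʳ seg₂ (∈-++⁺ʳ seg₃ s∈)))
  mirror : ∀ n₁ j₁ u → let N = suc n₁ * 2 + u * 2 + suc j₁ * 2 in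
    suc (suc (N + N)) ≡ j₁ * 2 + suc (suc n₁ * 2 + u) + (suc n₁ * 2 + u * 3 + suc j₁ * 2 + 3)
  mirror = solve-∀
  start₃ : ∀ n₁ u → suc n₁ * 2 + u ≡ u * 1 + suc n₁ * 2
  start₃ = solve-∀
  start₄ : ∀ n₁ j₁ u → suc n₁ * 2 + u + suc j₁ * 2 ≡ suc j₁ * 2 + (suc n₁ * 2 + u)
  start₄ = solve-∀
  covered : Covers P 1 (suc N)
  covered = covers-shrink (s≤s (≤-reflexive (sym (head-B n₁ j₁ u))))
    (covers-join (m≤m+n (n * 2) 1)
      (covers-descAP₂ 1 n in-A evens-B)
    (covers-join (≤-reflexive (start₃ n₁ u))
      (covers-descAP₁ (n * 2) u (in-B ∘ ∈-++⁺ʳ seg₁ ∘ ∈-++⁺ʳ seg₂ ∘ ∈-++⁺ˡ))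
    (covers-join (≤-reflexive (start₄ n₁ j₁ u))
      (covers-descAP₂ (n * 2 + u) j (in-B ∘ ∈-++⁺ʳ seg₁ ∘ ∈-++⁺ˡ)
        (inj₂ ∘ ∈-++⁺ʳ XA ∘ ∈-++⁺ʳ XB ∘ descAP-mirror (mirror n₁ j₁ u)))
      (covers-descAP₁ b₁ (suc u) (in-B ∘ ∈-++⁺ˡ)))))

  χla : ChiLaEq (Spider (2 * n) (2 * n + 2 * (j + 2 * u) + 1) (2 * j + 1)) 4
  χla =
    ChiLaEq-Spider (trans (cong (_* 2) (length-descAP 1 2 n)) (*-comm n 2))
                   (trans (cong (λ k → suc (k * 2)) |XB|≡) (lengthB n₁ j₁ u))
                   (trans (cong (λ k → k * 2 + 1) (length-descAP cb 2 j)) (cong (_+ 1) (*-comm j 2)))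
      (oddPairSpider q N _ _ _ _ _ _ refl |X|≡N (descAP₂-steps 1 n) stepsB (descAP₂-steps cb j) inner
         (head-B n₁ j₁ u) core≡ (inj₁ (final-descAP 1 2 n₁ , finalB≡2)) covered)

-- The case l = 2j + 1 with m − j odd, parametrised by n = n₁ + 1, j = j₁ + 1 and m = j + 2u + 1.
module OddThirdLegOddGap (n₁ j₁ u : ℕ) where
  n j N q b₁ cb : ℕ
  n = suc n₁
  j = suc j₁
  N = n * 2 + u * 2 + j * 2 + 1
  q = suc (suc (N + N))
  b₁ = n * 2 + u + j * 2 + 1
  cb = n * 2 + u * 3 + j * 2 + 4
  seg₁ seg₂ seg₃ seg₄ XA XB XC X : List ℕ
  seg₁ = descAP b₁ 1 (suc u)
  seg₂ = descAP (n * 2 + u + 1) 2 j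
  seg₃ = descAP (n * 2 + 1) 1 u
  seg₄ = descAP 1 2 n
  XA = descAP 2 2 n
  XB = seg₁ ++ seg₂ ++ seg₃ ++ seg₄
  XC = descAP cb 2 j
  X = XA ++ XB ++ XC

  |XB|≡ : length XB ≡ suc u + (j + (u + n))
  |XB|≡ = trans (length-++ seg₁) (cong₂ _+_ (length-descAP b₁ 1 (suc u))
            (trans (length-++ seg₂) (cong₂ _+_ (length-descAP _ 2 j)
              (trans (length-++ seg₃) (cong₂ _+_ (length-descAP _ 1 u) (length-descAP 1 2 n))))))
  lengthB : ∀ n₁ j₁ u → suc ((suc u + (suc j₁ + (u + suc n₁))) * 2) ≡ 2 * suc n₁ + 2 * (suc j₁ + (2 * u + 1)) + 1
  lengthB = solve-∀
  total : ∀ n₁ j₁ u → suc n₁ + (suc u + (suc j₁ + (u + suc n₁))) + suc j₁ ≡ suc n₁ * 2 + u * 2 + suc j₁ * 2 + 1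
  total = solve-∀
  |X|≡N : length XA + length XB + length XC ≡ N
  |X|≡N = trans (cong₂ _+_ (cong₂ _+_ (length-descAP 2 2 n) |XB|≡) (length-descAP cb 2 j)) (total n₁ j₁ u)

  join₁ : ∀ n₁ j₁ u → suc n₁ * 2 + u + suc j₁ * 2 + 1 ≡ 2 + (j₁ * 2 + (suc n₁ * 2 + u + 1))
  join₁ = solve-∀
  join₂ : ∀ u → Joins (descAP (suc n₁ * 2 + u + 1) 2 j) (descAP (suc n₁ * 2 + 1) 1 u ++ descAP 1 2 n)
  join₂ (suc u₁) = inj₁ (trans (final-descAP _ 2 j₁) (identity n₁ u₁))
    where
    identity : ∀ n₁ u₁ → suc n₁ * 2 + suc u₁ + 1 ≡ 1 + (u₁ * 1 + (suc n₁ * 2 + 1))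
    identity = solve-∀
  join₂ zero     = inj₂ (trans (final-descAP _ 2 j₁) (identity n₁))
    where
    identity : ∀ n₁ → suc n₁ * 2 + 0 + 1 ≡ 2 + (n₁ * 2 + 1)
    identity = solve-∀
  join₃ : ∀ u → Joins (descAP (suc n₁ * 2 + 1) 1 u) (descAP 1 2 n)
  join₃ zero     = tt
  join₃ (suc u₁) = inj₂ (trans (final-descAP _ 1 u₁) (identity n₁))
    where
    identity : ∀ n₁ → suc n₁ * 2 + 1 ≡ 2 + (n₁ * 2 + 1)
    identity = solve-∀
  stepsB : StepsDown XB
  stepsB = StepsDown-++ seg₁ (seg₂ ++ seg₃ ++ seg₄) (descAP₁-steps b₁ (suc u))
    (StepsDown-++ seg₂ (seg₃ ++ seg₄) (descAP₂-steps _ j)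
      (StepsDown-++ seg₃ seg₄ (descAP₁-steps _ u) (descAP₂-steps 1 n) (join₃ u)) (join₂ u))
    (inj₂ (trans (final-descAP b₁ 1 u) (join₁ n₁ j₁ u)))

  finalB≡1 : final XB ≡ 1
  finalB≡1 = trans (final-++ seg₁ _ _)
    (trans (cong final (sym (++-assoc seg₂ seg₃ seg₄))) (trans (final-++ (seg₂ ++ seg₃) _ _) (final-descAP 1 2 n₁)))

  head-B : ∀ n₁ j₁ u → u * 1 + (suc n₁ * 2 + u + suc j₁ * 2 + 1) ≡ suc n₁ * 2 + u * 2 + suc j₁ * 2 + 1
  head-B = solve-∀
  q≡ : ∀ n₁ j₁ u → let N = suc n₁ * 2 + u * 2 + suc j₁ * 2 + 1 in
    suc (suc (N + N)) ≡ (suc n₁ * 2 + u * 3 + suc j₁ * 2 + 4) + (suc n₁ * 2 + u + suc j₁ * 2)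
  q≡ = solve-∀
  core : ∀ n₁ j₁ u → let N = suc n₁ * 2 + u * 2 + suc j₁ * 2 + 1 in
    n₁ * 2 + 2 + (suc N + (j₁ * 2 + (suc n₁ * 2 + u * 3 + suc j₁ * 2 + 4))) ≡ (suc n₁ * 2 + u + suc j₁ * 2) + suc (suc (N + N))
  core = solve-∀
  core≡ : n₁ * 2 + 2 + (suc N + (j₁ * 2 + cb)) ≡ q ∸ final XC + q
  core≡ = trans (core n₁ j₁ u)
    (cong (_+ q) (sym (trans (cong (q ∸_) (final-descAP cb 2 j₁)) (trans (cong (_∸ cb) (q≡ n₁ j₁ u)) (m+n∸m≡n cb _)))))

  A-fits : ∀ n₁ j₁ u → let N = suc n₁ * 2 + u * 2 + suc j₁ * 2 + 1 in
    suc n₁ * 2 + 2 + (suc n₁ * 2 + u * 4 + suc j₁ * 4 + 2) ≡ suc (suc (N + N))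
  A-fits = solve-∀
  seg₁-fits : ∀ n₁ j₁ u → let N = suc n₁ * 2 + u * 2 + suc j₁ * 2 + 1 in
    suc u * 1 + (suc n₁ * 2 + u + suc j₁ * 2 + 1) + suc N ≡ suc (suc (N + N))
  seg₁-fits = solve-∀
  seg₂-fits : ∀ n₁ j₁ u → let N = suc n₁ * 2 + u * 2 + suc j₁ * 2 + 1 in
    suc j₁ * 2 + (suc n₁ * 2 + u + 1) + (suc n₁ * 2 + u * 3 + suc j₁ * 2 + 3) ≡ suc (suc (N + N))
  seg₂-fits = solve-∀
  seg₃-fits : ∀ n₁ j₁ u → let N = suc n₁ * 2 + u * 2 + suc j₁ * 2 + 1 in
    u * 1 + (suc n₁ * 2 + 1) + (suc n₁ * 2 + u * 3 + suc j₁ * 4 + 3) ≡ suc (suc (N + N))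
  seg₃-fits = solve-∀
  seg₄-fits : ∀ n₁ j₁ u → let N = suc n₁ * 2 + u * 2 + suc j₁ * 2 + 1 in
    suc n₁ * 2 + 1 + (suc n₁ * 2 + u * 4 + suc j₁ * 4 + 3) ≡ suc (suc (N + N))
  seg₄-fits = solve-∀
  C-fits : ∀ n₁ j₁ u → let N = suc n₁ * 2 + u * 2 + suc j₁ * 2 + 1 in
    suc j₁ * 2 + (suc n₁ * 2 + u * 3 + suc j₁ * 2 + 4) + (suc n₁ * 2 + u) ≡ suc (suc (N + N))
  C-fits = solve-∀
  inner : All (Inner q) X
  inner = ++⁺ (descAP-inner 2 2 n (s≤s z≤n) (s≤s z≤n) (≤-from-sum _ (A-fits n₁ j₁ u)))
         (++⁺ (++⁺ (descAP-inner b₁ 1 (suc u) (s≤s z≤n) (s≤s z≤n) (≤-from-sum _ (seg₁-fits n₁ j₁ u)))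
              (++⁺ (descAP-inner (n * 2 + u + 1) 2 j (s≤s z≤n) (s≤s z≤n) (≤-from-sum _ (seg₂-fits n₁ j₁ u)))
              (++⁺ (descAP-inner (n * 2 + 1) 1 u (s≤s z≤n) (s≤s z≤n) (≤-from-sum _ (seg₃-fits n₁ j₁ u)))
                   (descAP-inner 1 2 n (s≤s z≤n) (s≤s z≤n) (≤-from-sum _ (seg₄-fits n₁ j₁ u))))))
              (descAP-inner cb 2 j (s≤s z≤n) (s≤s z≤n) (≤-from-sum _ (C-fits n₁ j₁ u))))

  P : ℕ → Set
  P = PairCovered q X
  in-A : ∀ {s} → s ∈ XA → P s
  in-A = inj₁ ∘ ∈-++⁺ˡ
  in-B : ∀ {s} → s ∈ XB → P s
  in-B = inj₁ ∘ ∈-++⁺ʳ XA ∘ ∈-++⁺ˡ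
  mirror : ∀ n₁ j₁ u → let N = suc n₁ * 2 + u * 2 + suc j₁ * 2 + 1 in
    suc (suc (N + N)) ≡ j₁ * 2 + suc (suc n₁ * 2 + u + 1) + (suc n₁ * 2 + u * 3 + suc j₁ * 2 + 4)
  mirror = solve-∀
  start₃ : ∀ n₁ u → suc n₁ * 2 + u + 1 ≡ u * 1 + (suc n₁ * 2 + 1)
  start₃ = solve-∀
  start₄ : ∀ n₁ j₁ u → suc n₁ * 2 + u + suc j₁ * 2 + 1 ≡ suc j₁ * 2 + (suc n₁ * 2 + u + 1)
  start₄ = solve-∀
  covered : Covers P 1 (suc N)
  covered = covers-shrink (s≤s (≤-reflexive (sym (head-B n₁ j₁ u))))
    (covers-join ≤-refl
      (covers-descAP₂ 1 n (in-B ∘ ∈-++⁺ʳ seg₁ ∘ ∈-++⁺ʳ seg₂ ∘ ∈-++⁺ʳ seg₃) in-A)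
    (covers-join (≤-reflexive (start₃ n₁ u))
      (covers-descAP₁ (n * 2 + 1) u (in-B ∘ ∈-++⁺ʳ seg₁ ∘ ∈-++⁺ʳ seg₂ ∘ ∈-++⁺ˡ))
    (covers-join (≤-reflexive (start₄ n₁ j₁ u))
      (covers-descAP₂ (n * 2 + u + 1) j (in-B ∘ ∈-++⁺ʳ seg₁ ∘ ∈-++⁺ˡ)
        (inj₂ ∘ ∈-++⁺ʳ XA ∘ ∈-++⁺ʳ XB ∘ descAP-mirror (mirror n₁ j₁ u)))
      (covers-descAP₁ b₁ (suc u) (in-B ∘ ∈-++⁺ˡ)))))

  χla : ChiLaEq (Spider (2 * n) (2 * n + 2 * (j + (2 * u + 1)) + 1) (2 * j + 1)) 4
  χla =
    ChiLaEq-Spider (trans (cong (_* 2) (length-descAP 2 2 n)) (*-comm n 2))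
                   (trans (cong (λ k → suc (k * 2)) |XB|≡) (lengthB n₁ j₁ u))
                   (trans (cong (λ k → k * 2 + 1) (length-descAP cb 2 j)) (cong (_+ 1) (*-comm j 2)))
      (oddPairSpider q N _ _ _ _ _ _ refl |X|≡N (descAP₂-steps 2 n) stepsB (descAP₂-steps cb j) inner
         (head-B n₁ j₁ u) core≡ (inj₂ (final-descAP 2 2 n₁ , finalB≡1)) covered)

χla-even : ∀ n h t → 1 ≤ n → 1 ≤ h → ChiLaEq (Spider (2 * n) (2 * n + 2 * (h + t) + 1) (2 * h)) 4
χla-even (suc n₁) (suc h₁) t _ _ with ≤-<-connex (suc n₁) (suc h₁)
... | inj₁ n≤h with d , refl ← m≤n⇒∃[o]m+o≡n n≤h = EvenThirdLegLong.χla n₁ d t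
... | inj₂ h<n with d , refl ← m≤n⇒∃[o]m+o≡n h<n =
  subst (λ n → ChiLaEq (Spider (2 * n) (2 * n + 2 * (suc h₁ + t) + 1) (2 * suc h₁)) 4) (+-suc (suc h₁) d) (EvenThirdLegShort.χla h₁ d t)

even⊎odd : ∀ p → ∃[ u ] (p ≡ 2 * u ⊎ p ≡ 2 * u + 1)
even⊎odd zero = 0 , inj₁ refl
even⊎odd (suc p) with even⊎odd p
... | u , inj₁ refl = u , inj₂ (+-comm 1 (2 * u))
... | u , inj₂ refl = suc u , inj₁ (trans (cong suc (+-comm (2 * u) 1)) (sym (*-suc 2 u)))

χla-odd : ∀ n j p → 1 ≤ n → 1 ≤ j → ChiLaEq (Spider (2 * n) (2 * n + 2 * (j + p) + 1) (2 * j + 1)) 4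
χla-odd (suc n₁) (suc j₁) p _ _ with even⊎odd p
... | u , inj₁ refl = OddThirdLegEvenGap.χla n₁ j₁ u
... | u , inj₂ refl = OddThirdLegOddGap.χla n₁ j₁ u

positive-half : ∀ h → 2 ≤ 2 * h → 1 ≤ h
positive-half (suc h) _ = s≤s z≤n

positive-half′ : ∀ j → 2 ≤ 2 * j + 1 → 1 ≤ j
positive-half′ zero    (s≤s ())
positive-half′ (suc j) _ = s≤s z≤n

half-≤ : ∀ h m → 1 ≤ h → 2 * h ≤ m + 1 → h ≤ m
half-≤ h m 1≤h 2h≤m+1 =
  +-cancelʳ-≤ 1 h m (≤-trans (+-monoʳ-≤ h 1≤h) (subst (_≤ m + 1) (cong (h +_) (+-identityʳ h)) 2h≤m+1))

half-≤′ : ∀ j m → 2 * j + 1 ≤ m + 1 → j ≤ m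
half-≤′ j m 2j+1≤m+1 = ≤-trans (m≤m+n j (j + 0)) (+-cancelʳ-≤ 1 (2 * j) m 2j+1≤m+1)

theorem3p7 : (n m l : ℕ) → 1 ≤ n → 2 ≤ l → l ≤ m + 1 →
    ChiLaEq (Spider (2 * n) (2 * n + 2 * m + 1) l) 4
theorem3p7 n m l 1≤n 2≤l l≤m+1 with even⊎odd l
... | h , inj₁ refl with t , refl ← m≤n⇒∃[o]m+o≡n (half-≤ h m (positive-half h 2≤l) l≤m+1) =
  χla-even n h t 1≤n (positive-half h 2≤l)
... | j , inj₂ refl with p , refl ← m≤n⇒∃[o]m+o≡n (half-≤′ j m l≤m+1) =
  χla-odd n j p 1≤n (positive-half′ j 2≤l)
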